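{- For all integers $k,n\ge1$, \[ b_k(n)=\frac{1}{2^{k-1}}\sum_{\substack{r,s\ge 0,\ r+2s\le k\\ r\equiv k\ (\mathrm{mod}\ 2)}}(-2)^s\binom{k-s}{(k+r)/2}\binom{n}{s}r^n, \] and $a_k(n)=b_k(n)-b_{k-1}(n)$.
   Context: For a permutation $w=w_1\cdots w_n$ of $\{1,\dots,n\}$, a subsequence $w_{i_1}\cdots w_{i_k}$ ($i_1<\cdots<i_k$) is alternating if $w_{i_1}>w_{i_2}<w_{i_3}>w_{i_4}<\cdots$ (starting with a descent; length-$1$ sequences are alternating). Let $\mathrm{as}(w)$ be the maximum length of an alternating subsequence of $w$. Let $\mathfrak{S}_n$ be the symmetric group on $\{1,\dots,n\}$, $a_k(n)=\#\{w\in\mathfrak{S}_n:\mathrm{as}(w)=k\}$ and $b_k(n)=\#\{w\in\mathfrak{S}_n:\mathrm{as}(w)\le k\}$ (so $b_0(n)=0$ for $n\ge1$). -}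

module Defs where

open import Data.Bool using (Bool; true; false; _∧_; not; if_then_else_)
open import Data.Nat using (ℕ; zero; suc; _+_; _*_; _∸_; _^_; _<ᵇ_; _≡ᵇ_; _⊔_; _/_; _%_)
open import Data.Nat.Combinatorics using (_C_)
open import Data.List using (List; []; _∷_; length; map; concatMap; filterᵇ; foldr; upTo; sum)
open import Data.Integer as ℤ using (ℤ)

-- Permutations of {1,…,n}, written in one-line notation w₁⋯wₙ as lists.

words : ℕ → ℕ → List (List ℕ)
words n zero    = [] ∷ []
words n (suc m) = concatMap (λ x → map (x ∷_) (words n m)) (map suc (upTo n))

notIn : ℕ → List ℕ → Bool
notIn x []       = true
notIn x (y ∷ ys) = not (x ≡ᵇ y) ∧ notIn x ys

distinct : List ℕ → Bool
distinct []       = true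
distinct (x ∷ xs) = notIn x xs ∧ distinct xs

Sym : ℕ → List (List ℕ)
Sym n = filterᵇ distinct (words n n)

subseqs : List ℕ → List (List ℕ)
subseqs []       = [] ∷ []
subseqs (x ∷ xs) = map (x ∷_) (subseqs xs) Data.List.++ subseqs xs

mutual
  altDown : List ℕ → Bool
  altDown []           = true
  altDown (x ∷ [])     = true
  altDown (x ∷ y ∷ ys) = (y <ᵇ x) ∧ altUp (y ∷ ys)

  altUp : List ℕ → Bool
  altUp []           = true
  altUp (x ∷ [])     = true
  altUp (x ∷ y ∷ ys) = (x <ᵇ y) ∧ altDown (y ∷ ys)

maximum : List ℕ → ℕ
maximum = foldr _⊔_ 0

as : List ℕ → ℕ
as w = maximum (map length (filterᵇ altDown (subseqs w)))

count : {A : Set} → (A → Bool) → List A → ℕ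
count p xs = length (filterᵇ p xs)

a : ℕ → ℕ → ℕ
a k n = count (λ w → as w ≡ᵇ k) (Sym n)

b : ℕ → ℕ → ℕ
b k n = count (λ w → as w <ᵇ suc k) (Sym n)

-- Right-hand side of the formula, multiplied by 2^{k-1}:
--   Σ_{r,s ≥ 0, r + 2s ≤ k, r ≡ k (mod 2)} (-2)^s C(k-s,(k+r)/2) C(n,s) r^n
-- (r and s range over 0..k, which covers all pairs with r + 2s ≤ k)

_^ℤ_ : ℤ → ℕ → ℤ
x ^ℤ zero  = ℤ.+ 1
x ^ℤ suc m = x ℤ.* (x ^ℤ m)

sumℤ : List ℤ → ℤ
sumℤ = foldr ℤ._+_ (ℤ.+ 0)

term : ℕ → ℕ → ℕ → ℕ → ℤ
term k n r s =
  if ((r + 2 * s) <ᵇ suc k) ∧ ((r % 2) ≡ᵇ (k % 2))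
  then (ℤ.- (ℤ.+ 2)) ^ℤ s ℤ.* ℤ.+ (((k ∸ s) C ((k + r) / 2)) * (n C s) * (r ^ n))
  else ℤ.+ 0

rhsSum : ℕ → ℕ → ℤ
rhsSum k n = sumℤ (concatMap (λ r → map (λ s → term k n r s) (upTo (suc k))) (upTo (suc k)))

-- For a permutation w, as(w) is one more than the number of changes of direction
-- ("turns") of 0 w₁ ⋯ wₙ, since a longest alternating subsequence can be chosen
-- greedily through every turning point.  Inserting n + 1 into the n + 1 gaps of a
-- permutation with as(w) = j gives j permutations with as = j, one with j + 1 and
-- n - j with j + 2; summing over 𝔖ₙ yields, for n ≥ 1,
--   b_k(n+1) = k b_k(n) + (n + 1 - k) b_{k-2}(n),
-- so 2^(k-1) b_k(n) satisfies X_k(n+1) = k X_k(n) + 4 (n + 1 - k) X_{k-2}(n).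
-- Writing k = e + 2J and r = e + 2i, the right-hand side is Σ_i Q_{e+i+J, J-i}(n) r^n,
-- where Q_{A,m}(n) is the coefficient of x^m in (1 - 2x)^n / (1 - x)^(A+1); Pascal-type
-- identities for these coefficients and the three-term relation coming from the
-- differential equation of their generating function show that it satisfies the same
-- recurrence.  Both sides agree for k ≤ 1 and for n = 1, where the formula reduces to
-- sums over half a row of Pascal's triangle.

module Submission where

open import Defs

module Combinatorics where
  open import Data.Bool using (Bool; true; false; _∧_; not; _xor_; if_then_else_; T)
  open import Data.Bool.Properties using (not-involutive)
  open import Data.Nat using (ℕ; zero; suc; _+_; _*_; _∸_; _<ᵇ_; _≡ᵇ_; _≤_; _<_; _⊔_; z≤n; s≤s)
  open import Data.Nat.Properties
  open import Data.List using (List; []; _∷_; length; map; _++_; filterᵇ; concatMap; upTo)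
  open import Data.List.Properties using (filter-++; length-++; length-map; map-++; ∷-injectiveˡ; ∷-injectiveʳ)
  open import Data.List.Relation.Unary.All using (All; []; _∷_)
  import Data.List.Relation.Unary.All as All
  open import Data.List.Relation.Unary.All.Properties using (¬Any⇒All¬)
  open import Data.List.Relation.Unary.Any using (here; there)
  open import Data.List.Relation.Unary.Unique.Propositional using (Unique; []; _∷_)
  import Data.List.Relation.Unary.Unique.Propositional.Properties as Unique
  open import Data.List.Membership.Propositional using (_∈_; find; lose)
  open import Data.List.Membership.Propositional.Properties
    using (∈-++⁺ʳ; ∈-filter⁺; ∈-filter⁻; ∈-map⁺; ∈-map⁻; ∈-upTo⁺; ∈-upTo⁻; ∈-concatMap⁺; ∈-concatMap⁻)
  open import Data.List.Membership.DecPropositional Data.Nat._≟_ using (_∈?_)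
  open import Data.List.Membership.Propositional.Properties.WithK using (unique∧set⇒bag)
  open import Data.List.Relation.Binary.BagAndSetEquality using (∼bag⇒↭)
  open import Data.List.Relation.Binary.Permutation.Propositional using (_↭_)
  open import Data.List.Relation.Binary.Permutation.Propositional.Properties using (↭-length; filter-↭)
  open import Data.Nat.Tactic.RingSolver using (solve-∀)
  open import Data.Product using (Σ; ∃₂; _×_; _,_; proj₁; proj₂; uncurry)
  open import Function.Bundles using (mk⇔)
  open import Data.Sum using (_⊎_; inj₁; inj₂)
  open import Relation.Binary.PropositionalEquality
  open import Relation.Binary.Definitions using (tri<; tri≈; tri>)
  open import Relation.Nullary.Decidable.Core using (T?)
  open import Function using (_∘_)
  open import Relation.Nullary using (¬_; yes; no; contradiction)

  χ : Bool → ℕ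
  χ true  = 1
  χ false = 0

  T⇒≡true : ∀ {b} → T b → b ≡ true
  T⇒≡true {true} _ = refl

  ≡true⇒T : ∀ {b} → b ≡ true → T b
  ≡true⇒T refl = _

  <ᵇ-true : ∀ {m n} → m < n → (m <ᵇ n) ≡ true
  <ᵇ-true m<n = T⇒≡true (<⇒<ᵇ m<n)

  <ᵇ-false : ∀ {m n} → n ≤ m → (m <ᵇ n) ≡ false
  <ᵇ-false {m} {n} n≤m with m <ᵇ n in eq
  ... | false = refl
  ... | true  = contradiction (<ᵇ⇒< m n (≡true⇒T eq)) (≤⇒≯ n≤m)

  <ᵇ≡true⇒< : ∀ m n → (m <ᵇ n) ≡ true → m < n
  <ᵇ≡true⇒< m n eq = <ᵇ⇒< m n (≡true⇒T eq)

  -- Alternating subsequences and turns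

  step : Bool → ℕ → ℕ → Bool
  step true  p y = p <ᵇ y
  step false p y = y <ᵇ p

  alt : Bool → List ℕ → Bool
  alt true  = altUp
  alt false = altDown

  alt-∷-∷ : ∀ u p y s → alt u (p ∷ y ∷ s) ≡ step u p y ∧ alt (not u) (y ∷ s)
  alt-∷-∷ true  p y s = refl
  alt-∷-∷ false p y s = refl

  alt-[-] : ∀ u y → alt u (y ∷ []) ≡ true
  alt-[-] true  y = refl
  alt-[-] false y = refl

  step-flip : ∀ u p y → step u p y ≡ step (not u) y p
  step-flip true  p y = refl
  step-flip false p y = refl

  step-trans : ∀ u a b c → step u a b ≡ true → step u b c ≡ true → step u a c ≡ true
  step-trans true  a b c ab bc = <ᵇ-true (<-trans (<ᵇ≡true⇒< a b ab) (<ᵇ≡true⇒< b c bc))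
  step-trans false a b c ab bc = <ᵇ-true (<-trans (<ᵇ≡true⇒< c b bc) (<ᵇ≡true⇒< b a ab))

  step-not : ∀ u a b → step u a b ≡ true → step (not u) a b ≡ false
  step-not true  a b ab = <ᵇ-false (<⇒≤ (<ᵇ≡true⇒< a b ab))
  step-not false a b ab = <ᵇ-false (<⇒≤ (<ᵇ≡true⇒< b a ab))

  step-direction : ∀ u a b → step u a b ≡ true → (a <ᵇ b) ≡ u
  step-direction true  a b ab = ab
  step-direction false a b ab = <ᵇ-false (<⇒≤ (<ᵇ≡true⇒< b a ab))

  step-either : ∀ u {a b} → a ≢ b → step u a b ≡ true ⊎ step (not u) a b ≡ true
  step-either u {a} {b} a≢b with <-cmp a b | u
  ... | tri< a<b _ _ | true  = inj₁ (<ᵇ-true a<b)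
  ... | tri< a<b _ _ | false = inj₂ (<ᵇ-true a<b)
  ... | tri≈ _ a≡b _ | _     = contradiction a≡b a≢b
  ... | tri> _ _ b<a | true  = inj₂ (<ᵇ-true b<a)
  ... | tri> _ _ b<a | false = inj₁ (<ᵇ-true b<a)

  maxLength : List (List ℕ) → ℕ
  maxLength ss = maximum (map length ss)

  maximum-++ : ∀ xs ys → maximum (xs ++ ys) ≡ maximum xs ⊔ maximum ys
  maximum-++ []       ys = refl
  maximum-++ (x ∷ xs) ys = trans (cong (x ⊔_) (maximum-++ xs ys)) (sym (⊔-assoc x (maximum xs) (maximum ys)))

  maxLength-++ : ∀ ss ts → maxLength (ss ++ ts) ≡ maxLength ss ⊔ maxLength ts
  maxLength-++ ss ts = trans (cong maximum (map-++ length ss ts)) (maximum-++ (map length ss) (map length ts))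

  maxLength-map-∷ : ∀ y s ss → maxLength (map (y ∷_) (s ∷ ss)) ≡ suc (maxLength (s ∷ ss))
  maxLength-map-∷ y s []        = trans (⊔-identityʳ _) (cong suc (sym (⊔-identityʳ _)))
  maxLength-map-∷ y s (s′ ∷ ss) = cong (suc (length s) ⊔_) (maxLength-map-∷ y s′ ss)

  filterᵇ-map-∷ : ∀ (q r : List ℕ → Bool) c y → (∀ s → q (y ∷ s) ≡ c ∧ r s) → ∀ ss →
    filterᵇ q (map (y ∷_) ss) ≡ (if c then map (y ∷_) (filterᵇ r ss) else [])
  filterᵇ-map-∷ q r c y hq []       with c
  ... | true  = refl
  ... | false = refl
  filterᵇ-map-∷ q r c y hq (s ∷ ss) rewrite hq s with c | r s | filterᵇ-map-∷ q r c y hq ss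
  ... | true  | true  | ih = cong ((y ∷ s) ∷_) ih
  ... | true  | false | ih = ih
  ... | false | _     | ih = ih

  []∈subseqs : ∀ xs → [] ∈ subseqs xs
  []∈subseqs []       = here refl
  []∈subseqs (x ∷ xs) = ∈-++⁺ʳ (map (x ∷_) (subseqs xs)) ([]∈subseqs xs)

  ∈⇒∷ : ∀ {A : Set} {x : A} {xs} → x ∈ xs → ∃₂ λ z zs → xs ≡ z ∷ zs
  ∈⇒∷ (here _)  = _ , _ , refl
  ∈⇒∷ (there _) = _ , _ , refl

  maxLength-filter-subseqs-∷ : ∀ (q r : List ℕ → Bool) c y ys →
    (∀ s → q (y ∷ s) ≡ c ∧ r s) → r [] ≡ true →
    maxLength (filterᵇ q (subseqs (y ∷ ys)))
      ≡ (if c then suc (maxLength (filterᵇ r (subseqs ys))) else 0) ⊔ maxLength (filterᵇ q (subseqs ys))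
  maxLength-filter-subseqs-∷ q r c y ys hq r[] =
    begin
      maxLength (filterᵇ q (map (y ∷_) (subseqs ys) ++ subseqs ys))
    ≡⟨ cong maxLength (filter-++ (T? ∘ q) (map (y ∷_) (subseqs ys)) (subseqs ys)) ⟩
      maxLength (filterᵇ q (map (y ∷_) (subseqs ys)) ++ filterᵇ q (subseqs ys))
    ≡⟨ maxLength-++ (filterᵇ q (map (y ∷_) (subseqs ys))) _ ⟩
      maxLength (filterᵇ q (map (y ∷_) (subseqs ys))) ⊔ maxLength (filterᵇ q (subseqs ys))
    ≡⟨ cong (_⊔ maxLength (filterᵇ q (subseqs ys)))
            (trans (cong maxLength (filterᵇ-map-∷ q r c y hq (subseqs ys))) (extend c)) ⟩
      (if c then suc (maxLength (filterᵇ r (subseqs ys))) else 0) ⊔ maxLength (filterᵇ q (subseqs ys))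
    ∎
    where
    open ≡-Reasoning
    extend : ∀ c → maxLength (if c then map (y ∷_) (filterᵇ r (subseqs ys)) else [])
                   ≡ (if c then suc (maxLength (filterᵇ r (subseqs ys))) else 0)
    extend false = refl
    extend true with ∈⇒∷ (∈-filter⁺ (T? ∘ r) ([]∈subseqs ys) (≡true⇒T r[]))
    ... | s , ss , eq rewrite eq = maxLength-map-∷ y s ss

  longestAlt : Bool → ℕ → List ℕ → ℕ
  longestAlt u p xs = maxLength (filterᵇ (λ s → alt u (p ∷ s)) (subseqs xs))

  longestAlt-[] : ∀ u p → longestAlt u p [] ≡ 0
  longestAlt-[] true  p = refl
  longestAlt-[] false p = refl

  longestAlt-∷ : ∀ u p y ys →
    longestAlt u p (y ∷ ys) ≡ (if step u p y then suc (longestAlt (not u) y ys) else 0) ⊔ longestAlt u p ys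
  longestAlt-∷ u p y ys =
    maxLength-filter-subseqs-∷ _ _ (step u p y) y ys (alt-∷-∷ u p y) (alt-[-] (not u) y)

  as-∷ : ∀ y ys → as (y ∷ ys) ≡ suc (longestAlt false y ys) ⊔ as ys
  as-∷ y ys = maxLength-filter-subseqs-∷ altDown _ true y ys (λ s → refl) refl

  as≡longestAlt : ∀ xs → All (0 <_) xs → as xs ≡ longestAlt true 0 xs
  as≡longestAlt []           []      = refl
  as≡longestAlt (suc y ∷ ys) (_ ∷ h) =
    trans (as-∷ (suc y) ys) (trans (cong (suc (longestAlt false (suc y) ys) ⊔_) (as≡longestAlt ys h))
                                   (sym (longestAlt-∷ true 0 (suc y) ys)))

  longestAlt-take : ∀ u p y ys → step u p y ≡ true →
    longestAlt u p (y ∷ ys) ≡ suc (longestAlt (not u) y ys) ⊔ longestAlt u p ys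
  longestAlt-take u p y ys eq = trans (longestAlt-∷ u p y ys) (cong (λ c → (if c then _ else 0) ⊔ _) eq)

  longestAlt-skip : ∀ u p y ys → step u p y ≡ false → longestAlt u p (y ∷ ys) ≡ longestAlt u p ys
  longestAlt-skip u p y ys eq = trans (longestAlt-∷ u p y ys) (cong (λ c → (if c then _ else 0) ⊔ _) eq)

  longestAlt-∷-≥ : ∀ u p y ys → longestAlt u p ys ≤ longestAlt u p (y ∷ ys)
  longestAlt-∷-≥ u p y ys = subst (longestAlt u p ys ≤_) (sym (longestAlt-∷ u p y ys)) (m≤n⊔m _ _)

  longestAlt-mono : ∀ u p q → (∀ z → step u p z ≡ true → step u q z ≡ true) →
    ∀ xs → longestAlt u p xs ≤ longestAlt u q xs
  longestAlt-mono u p q h [] = ≤-reflexive (trans (longestAlt-[] u p) (sym (longestAlt-[] u q)))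
  longestAlt-mono u p q h (z ∷ zs) with step u p z in pz
  ... | true  = begin
      longestAlt u p (z ∷ zs)                          ≡⟨ longestAlt-take u p z zs pz ⟩
      suc (longestAlt (not u) z zs) ⊔ longestAlt u p zs ≤⟨ ⊔-monoʳ-≤ _ (longestAlt-mono u p q h zs) ⟩
      suc (longestAlt (not u) z zs) ⊔ longestAlt u q zs ≡⟨ longestAlt-take u q z zs (h z pz) ⟨
      longestAlt u q (z ∷ zs)                          ∎
    where open ≤-Reasoning
  ... | false = begin
      longestAlt u p (z ∷ zs) ≡⟨ longestAlt-skip u p z zs pz ⟩
      longestAlt u p zs       ≤⟨ longestAlt-mono u p q h zs ⟩
      longestAlt u q zs       ≤⟨ longestAlt-∷-≥ u q z zs ⟩
      longestAlt u q (z ∷ zs) ∎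
    where open ≤-Reasoning

  longestAlt-past : ∀ u p y → step u p y ≡ true → ∀ ys → All (y ≢_) ys →
    longestAlt u p ys ≤ suc (longestAlt (not u) y ys) ⊔ longestAlt u y ys
  longestAlt-past u p y py [] [] = subst (_≤ _) (sym (longestAlt-[] u p)) z≤n
  longestAlt-past u p y py (z ∷ zs) (y≢z ∷ h) =
    subst (_≤ bound) (sym (longestAlt-∷ u p z zs)) (⊔-lub viaZ (≤-trans (longestAlt-past u p y py zs h) weaken))
    where
    bound = suc (longestAlt (not u) y (z ∷ zs)) ⊔ longestAlt u y (z ∷ zs)
    weaken : suc (longestAlt (not u) y zs) ⊔ longestAlt u y zs ≤ bound
    weaken = ⊔-mono-≤ (s≤s (longestAlt-∷-≥ (not u) y z zs)) (longestAlt-∷-≥ u y z zs)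
    viaZ : (if step u p z then suc (longestAlt (not u) z zs) else 0) ≤ bound
    viaZ with step u p z
    ... | false = z≤n
    ... | true with step-either u y≢z
    ...   | inj₁ yz = m≤n⇒m≤o⊔n (suc (longestAlt (not u) y (z ∷ zs)))
                        (≤-trans (m≤m⊔n _ (longestAlt u y zs)) (≤-reflexive (sym (longestAlt-take u y z zs yz))))
    ...   | inj₂ yz = m≤n⇒m≤n⊔o (longestAlt u y (z ∷ zs)) (s≤s (≤-trans (longestAlt-mono (not u) z y (λ w → step-trans (not u) y z w yz) zs)
                                                  (longestAlt-∷-≥ (not u) y z zs)))

  longestAlt-behind : ∀ u p y ys → step u p y ≡ true → longestAlt (not u) p (y ∷ ys) ≤ longestAlt (not u) y ys
  longestAlt-behind u p y ys py = begin
    longestAlt (not u) p (y ∷ ys) ≡⟨ longestAlt-skip (not u) p y ys (step-not u p y py) ⟩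
    longestAlt (not u) p ys       ≤⟨ longestAlt-mono (not u) p y (λ w → step-trans (not u) y p w yp) ys ⟩
    longestAlt (not u) y ys       ∎
    where
    open ≤-Reasoning
    yp : step (not u) y p ≡ true
    yp = trans (sym (step-flip u p y)) py

  -- turns u p xs counts the changes of direction along p ∷ xs, where u records
  -- whether p itself was reached by an ascent.
  turns : Bool → ℕ → List ℕ → ℕ
  turns u p []       = 0
  turns u p (y ∷ ys) = χ (u xor (p <ᵇ y)) + turns (p <ᵇ y) y ys

  turns-∷ : ∀ u y z zs v → (y <ᵇ z) ≡ v → turns u y (z ∷ zs) ≡ χ (u xor v) + turns v z zs
  turns-∷ u y z zs v refl = refl

  χ-xor-self : ∀ u → χ (u xor u) ≡ 0
  χ-xor-self true  = refl
  χ-xor-self false = refl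

  χ-xor-not : ∀ u → χ (u xor not u) ≡ 1
  χ-xor-not true  = refl
  χ-xor-not false = refl

  -- For distinct entries a longest alternating continuation can be chosen greedily
  -- through every turning point; the bound for starting in the other direction is
  -- what carries the induction.
  longestAlt-turns : ∀ u p y ys → Unique (y ∷ ys) → step u p y ≡ true →
    longestAlt u p (y ∷ ys) ≡ suc (turns u y ys) × longestAlt (not u) p (y ∷ ys) ≤ turns u y ys
  longestAlt-turns u p y [] _ py =
    trans (longestAlt-take u p y [] py) (cong₂ (λ m n → suc m ⊔ n) (longestAlt-[] (not u) y) (longestAlt-[] u p)) ,
    subst (_≤ 0) (sym (trans (longestAlt-skip (not u) p y [] (step-not u p y py)) (longestAlt-[] (not u) p))) z≤n
  longestAlt-turns u p y ys@(z ∷ zs) ((y≢z ∷ y∉) ∷ uniq) py with step-either u y≢z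
  ... | inj₁ yz = subst (λ t → longestAlt u p (y ∷ ys) ≡ suc t × longestAlt (not u) p (y ∷ ys) ≤ t)
                        (sym turns≡) (upward , ≤-trans (longestAlt-behind u p y ys py) (proj₂ ih))
    where
    ih = longestAlt-turns u y z zs uniq yz
    turns≡ : turns u y ys ≡ turns u z zs
    turns≡ = trans (turns-∷ u y z zs u (step-direction u y z yz)) (cong (_+ turns u z zs) (χ-xor-self u))
    upward : longestAlt u p (y ∷ ys) ≡ suc (turns u z zs)
    upward = trans (longestAlt-take u p y ys py) (≤-antisym
      (⊔-lub (s≤s (proj₂ ih))
             (≤-trans (longestAlt-past u p y py ys (y≢z ∷ y∉)) (⊔-lub (s≤s (proj₂ ih)) (≤-reflexive (proj₁ ih)))))
      (≤-trans (≤-reflexive (sym (proj₁ ih)))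
               (≤-trans (longestAlt-mono u y p (λ w → step-trans u p y w py) ys) (m≤n⊔m _ _))))
  ... | inj₂ yz = subst (λ t → longestAlt u p (y ∷ ys) ≡ suc t × longestAlt (not u) p (y ∷ ys) ≤ t)
                        (sym turns≡) (upward , ≤-trans (longestAlt-behind u p y ys py) (≤-reflexive (proj₁ ih)))
    where
    ih = longestAlt-turns (not u) y z zs uniq yz
    turns≡ : turns u y ys ≡ suc (turns (not u) z zs)
    turns≡ = trans (turns-∷ u y z zs (not u) (step-direction (not u) y z yz)) (cong (_+ turns (not u) z zs) (χ-xor-not u))
    onward : longestAlt u y ys ≤ turns (not u) z zs
    onward = subst (λ v → longestAlt v y ys ≤ turns (not u) z zs) (not-involutive u) (proj₂ ih)
    upward : longestAlt u p (y ∷ ys) ≡ suc (suc (turns (not u) z zs))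
    upward = trans (longestAlt-take u p y ys py) (trans (cong (λ m → suc m ⊔ longestAlt u p ys) (proj₁ ih))
      (m≥n⇒m⊔n≡m (≤-trans (longestAlt-past u p y py ys (y≢z ∷ y∉))
                           (⊔-lub (≤-reflexive (cong suc (proj₁ ih))) (≤-trans onward (≤-trans (n≤1+n _) (n≤1+n _)))))))

  as≡suc-turns : ∀ y ys → All (0 <_) (y ∷ ys) → Unique (y ∷ ys) → as (y ∷ ys) ≡ suc (turns true 0 (y ∷ ys))
  as≡suc-turns zero    ys (() ∷ _) _
  as≡suc-turns (suc y) ys allPos   uniq =
    trans (as≡longestAlt (suc y ∷ ys) allPos) (proj₁ (longestAlt-turns true 0 (suc y) ys uniq refl))

  -- 𝔖ₙ₊₁ by inserting n + 1 into the permutations in 𝔖ₙ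

  insertions : ℕ → List ℕ → List (List ℕ)
  insertions M []       = (M ∷ []) ∷ []
  insertions M (x ∷ xs) = (M ∷ x ∷ xs) ∷ map (x ∷_) (insertions M xs)

  delete : ℕ → List ℕ → List ℕ
  delete M []       = []
  delete M (y ∷ ys) = if M ≡ᵇ y then ys else y ∷ delete M ys

  InRange : ℕ → ℕ → Set
  InRange n x = 0 < x × x ≤ n

  IsPermutation : ℕ → List ℕ → Set
  IsPermutation n v = length v ≡ n × All (InRange n) v × Unique v

  ≡ᵇ-refl : ∀ m → (m ≡ᵇ m) ≡ true
  ≡ᵇ-refl zero    = refl
  ≡ᵇ-refl (suc m) = ≡ᵇ-refl m

  ≡ᵇ-false : ∀ {m n} → m ≢ n → (m ≡ᵇ n) ≡ false
  ≡ᵇ-false {m} {n} m≢n with m ≡ᵇ n in eq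
  ... | false = refl
  ... | true  = contradiction (≡ᵇ⇒≡ m n (subst T (sym eq) _)) m≢n

  notIn⇒All≢ : ∀ x v → notIn x v ≡ true → All (x ≢_) v
  notIn⇒All≢ x []      _  = []
  notIn⇒All≢ x (y ∷ v) eq with x ≡ᵇ y in x≟y
  ... | false = (λ x≡y → subst T x≟y (≡⇒≡ᵇ x y x≡y)) ∷ notIn⇒All≢ x v eq

  All≢⇒notIn : ∀ x v → All (x ≢_) v → notIn x v ≡ true
  All≢⇒notIn x []      []         = refl
  All≢⇒notIn x (y ∷ v) (x≢y ∷ h) rewrite ≡ᵇ-false x≢y = All≢⇒notIn x v h

  distinct⇒Unique : ∀ v → distinct v ≡ true → Unique v
  distinct⇒Unique []      _  = []
  distinct⇒Unique (x ∷ v) eq with notIn x v in fresh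
  ... | true = notIn⇒All≢ x v fresh ∷ distinct⇒Unique v eq

  Unique⇒distinct : ∀ v → Unique v → distinct v ≡ true
  Unique⇒distinct []      []        = refl
  Unique⇒distinct (x ∷ v) (h ∷ u) rewrite All≢⇒notIn x v h = Unique⇒distinct v u

  ∈-alphabet⁻ : ∀ {n x} → x ∈ map suc (upTo n) → InRange n x
  ∈-alphabet⁻ x∈ with ∈-map⁻ suc x∈
  ... | i , i∈ , refl = s≤s z≤n , ∈-upTo⁻ i∈

  ∈-alphabet⁺ : ∀ {n x} → InRange n x → x ∈ map suc (upTo n)
  ∈-alphabet⁺ {x = suc x} (_ , x<n) = ∈-map⁺ suc (∈-upTo⁺ x<n)

  ∈-words⁻ : ∀ n m {v} → v ∈ words n m → length v ≡ m × All (InRange n) v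
  ∈-words⁻ n zero    (here refl) = refl , []
  ∈-words⁻ n (suc m) v∈ with find (∈-concatMap⁻ (λ x → map (x ∷_) (words n m)) {xs = map suc (upTo n)} v∈)
  ... | x , x∈ , v∈x with ∈-map⁻ (x ∷_) v∈x
  ...   | v′ , v′∈ , refl = cong suc (proj₁ (∈-words⁻ n m v′∈)) , ∈-alphabet⁻ x∈ ∷ proj₂ (∈-words⁻ n m v′∈)

  ∈-words⁺ : ∀ n m {v} → length v ≡ m → All (InRange n) v → v ∈ words n m
  ∈-words⁺ n zero    {[]}    refl []        = here refl
  ∈-words⁺ n (suc m) {x ∷ v} eq   (x∈ ∷ v∈) =
    ∈-concatMap⁺ (λ y → map (y ∷_) (words n m)) (lose (∈-alphabet⁺ x∈) (∈-map⁺ (x ∷_) (∈-words⁺ n m (suc-injective eq) v∈)))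

  words-unique : ∀ n m → Unique (words n m)
  words-unique n zero    = [] ∷ []
  words-unique n (suc m) = prefixed (map suc (upTo n)) (Unique.map⁺ suc-injective (Unique.upTo⁺ n))
    where
    prefixed : ∀ xs → Unique xs → Unique (concatMap (λ x → map (x ∷_) (words n m)) xs)
    prefixed []       _         = []
    prefixed (x ∷ xs) (x∉ ∷ u) = Unique.++⁺ (Unique.map⁺ ∷-injectiveʳ (words-unique n m)) (prefixed xs u) disjoint
      where
      disjoint : ∀ {v} → ¬ (v ∈ map (x ∷_) (words n m) × v ∈ concatMap (λ x → map (x ∷_) (words n m)) xs)
      disjoint (v∈x , v∈xs) with ∈-map⁻ (x ∷_) v∈x | find (∈-concatMap⁻ (λ x → map (x ∷_) (words n m)) {xs = xs} v∈xs)
      ... | _ , _ , refl | y , y∈ , v∈y with ∈-map⁻ (y ∷_) v∈y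
      ...   | _ , _ , eq = All.lookup x∉ y∈ (∷-injectiveˡ eq)

  ∈-Sym⁻ : ∀ n {v} → v ∈ Sym n → IsPermutation n v
  ∈-Sym⁻ n v∈ with ∈-filter⁻ (T? ∘ distinct) v∈
  ... | v∈words , dist with ∈-words⁻ n n v∈words
  ...   | len , range = len , range , distinct⇒Unique _ (T⇒≡true dist)

  ∈-Sym⁺ : ∀ n {v} → IsPermutation n v → v ∈ Sym n
  ∈-Sym⁺ n (len , range , uniq) = ∈-filter⁺ (T? ∘ distinct) (∈-words⁺ n n len range) (≡true⇒T (Unique⇒distinct _ uniq))

  Sym-unique : ∀ n → Unique (Sym n)
  Sym-unique n = Unique.filter⁺ (T? ∘ distinct) (words-unique n n)

  length-∈-insertions : ∀ M w {v} → v ∈ insertions M w → length v ≡ suc (length w)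
  length-∈-insertions M []      (here refl) = refl
  length-∈-insertions M (x ∷ w) (here refl) = refl
  length-∈-insertions M (x ∷ w) (there v∈) with ∈-map⁻ (x ∷_) v∈
  ... | _ , v∈w , refl = cong suc (length-∈-insertions M w v∈w)

  All-∈-insertions : ∀ {P : ℕ → Set} M w {v} → P M → All P w → v ∈ insertions M w → All P v
  All-∈-insertions M []      pM []         (here refl) = pM ∷ []
  All-∈-insertions M (x ∷ w) pM pw         (here refl) = pM ∷ pw
  All-∈-insertions M (x ∷ w) pM (px ∷ pw) (there v∈) with ∈-map⁻ (x ∷_) v∈
  ... | _ , v∈w , refl = px ∷ All-∈-insertions M w pM pw v∈w

  Unique-∈-insertions : ∀ M w {v} → All (M ≢_) w → Unique w → v ∈ insertions M w → Unique v
  Unique-∈-insertions M []      _          _          (here refl) = [] ∷ []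
  Unique-∈-insertions M (x ∷ w) M∉         uniq       (here refl) = M∉ ∷ uniq
  Unique-∈-insertions M (x ∷ w) (M≢x ∷ M∉) (x∉ ∷ u) (there v∈) with ∈-map⁻ (x ∷_) v∈
  ... | _ , v∈w , refl = All-∈-insertions M w (M≢x ∘ sym) x∉ v∈w ∷ Unique-∈-insertions M w M∉ u v∈w

  delete-insertions : ∀ M w {v} → All (M ≢_) w → v ∈ insertions M w → delete M v ≡ w
  delete-insertions M []      _          (here refl) rewrite ≡ᵇ-refl M = refl
  delete-insertions M (x ∷ w) _          (here refl) rewrite ≡ᵇ-refl M = refl
  delete-insertions M (x ∷ w) (M≢x ∷ M∉) (there v∈) with ∈-map⁻ (x ∷_) v∈
  ... | v , v∈w , refl rewrite ≡ᵇ-false M≢x = cong (x ∷_) (delete-insertions M w M∉ v∈w)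

  insertions-delete : ∀ M v → M ∈ v → v ∈ insertions M (delete M v)
  insertions-delete M (y ∷ v) M∈ with M ≡ᵇ y in M≟y
  ... | true rewrite ≡ᵇ⇒≡ M y (≡true⇒T M≟y) with v
  ...   | []    = here refl
  ...   | _ ∷ _ = here refl
  insertions-delete M (y ∷ v) (here M≡y) | false = contradiction (≡⇒≡ᵇ M y M≡y) (subst T M≟y)
  insertions-delete M (y ∷ v) (there M∈) | false = there (∈-map⁺ (y ∷_) (insertions-delete M v M∈))

  insertions-unique : ∀ M w → All (M ≢_) w → Unique (insertions M w)
  insertions-unique M []      _          = [] ∷ []
  insertions-unique M (x ∷ w) (M≢x ∷ M∉) = All.tabulate headFresh ∷ Unique.map⁺ ∷-injectiveʳ (insertions-unique M w M∉)
    where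
    headFresh : ∀ {v} → v ∈ map (x ∷_) (insertions M w) → M ∷ x ∷ w ≢ v
    headFresh v∈ eq with ∈-map⁻ (x ∷_) v∈
    ... | _ , _ , refl = M≢x (∷-injectiveˡ eq)

  concatMap-insertions-unique : ∀ M ws → Unique ws → All (All (M ≢_)) ws → Unique (concatMap (insertions M) ws)
  concatMap-insertions-unique M []       _         _          = []
  concatMap-insertions-unique M (w ∷ ws) (w∉ ∷ u) (M∉ ∷ M∉s) =
    Unique.++⁺ (insertions-unique M w M∉) (concatMap-insertions-unique M ws u M∉s) disjoint
    where
    disjoint : ∀ {v} → ¬ (v ∈ insertions M w × v ∈ concatMap (insertions M) ws)
    disjoint (v∈w , v∈ws) with find (∈-concatMap⁻ (insertions M) {xs = ws} v∈ws)
    ... | w′ , w′∈ , v∈w′ = All.lookup w∉ w′∈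
      (trans (sym (delete-insertions M w M∉ v∈w)) (delete-insertions M w′ (All.lookup M∉s w′∈) v∈w′))

  length-delete : ∀ M v → M ∈ v → length v ≡ suc (length (delete M v))
  length-delete M (y ∷ v) M∈ with M ≡ᵇ y in M≟y
  ... | true = refl
  length-delete M (y ∷ v) (here M≡y) | false = contradiction (≡⇒≡ᵇ M y M≡y) (subst T M≟y)
  length-delete M (y ∷ v) (there M∈) | false = cong suc (length-delete M v M∈)

  All-delete : ∀ {P : ℕ → Set} M v → All P v → All P (delete M v)
  All-delete M []      []         = []
  All-delete M (y ∷ v) (py ∷ pv) with M ≡ᵇ y
  ... | true  = pv
  ... | false = py ∷ All-delete M v pv

  delete-fresh : ∀ M v → Unique v → All (M ≢_) (delete M v)
  delete-fresh M []      []        = []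
  delete-fresh M (y ∷ v) (y∉ ∷ u) with M ≡ᵇ y in M≟y
  ... | true rewrite ≡ᵇ⇒≡ M y (≡true⇒T M≟y) = y∉
  ... | false = (λ M≡y → subst T M≟y (≡⇒≡ᵇ M y M≡y)) ∷ delete-fresh M v u

  Unique-delete : ∀ M v → Unique v → Unique (delete M v)
  Unique-delete M []      []        = []
  Unique-delete M (y ∷ v) (y∉ ∷ u) with M ≡ᵇ y
  ... | true  = u
  ... | false = All-delete M v y∉ ∷ Unique-delete M v u

  InRange-pred : ∀ n {x} → InRange (suc n) x → suc n ≢ x → InRange n x
  InRange-pred n (0<x , x≤1+n) 1+n≢x = 0<x , ≤-pred (≤∧≢⇒< x≤1+n (1+n≢x ∘ sym))

  InRange-delete-max : ∀ n v → Unique v → All (InRange (suc n)) v → All (InRange n) (delete (suc n) v)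
  InRange-delete-max n v uniq range = All.zipWith (uncurry (InRange-pred n)) (All-delete (suc n) v range , delete-fresh (suc n) v uniq)

  InRange-without-max : ∀ n v → ¬ (suc n ∈ v) → All (InRange (suc n)) v → All (InRange n) v
  InRange-without-max n v 1+n∉v range = All.zipWith (uncurry (InRange-pred n)) (range , ¬Any⇒All¬ v 1+n∉v)

  pigeonhole : ∀ n v → Unique v → All (InRange n) v → length v ≤ n
  pigeonhole zero    []      _    _                  = z≤n
  pigeonhole zero    (x ∷ v) _    ((0<x , x≤0) ∷ _) = contradiction x≤0 (<⇒≱ 0<x)
  pigeonhole (suc n) v       uniq range with suc n ∈? v
  ... | yes 1+n∈v = begin
      length v                        ≡⟨ length-delete (suc n) v 1+n∈v ⟩
      suc (length (delete (suc n) v)) ≤⟨ s≤s (pigeonhole n _ (Unique-delete (suc n) v uniq) (InRange-delete-max n v uniq range)) ⟩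
      suc n                           ∎
    where open ≤-Reasoning
  ... | no 1+n∉v = m≤n⇒m≤1+n (pigeonhole n v uniq (InRange-without-max n v 1+n∉v range))

  max∈permutation : ∀ n v → IsPermutation (suc n) v → suc n ∈ v
  max∈permutation n v (len , range , uniq) with suc n ∈? v
  ... | yes 1+n∈v = 1+n∈v
  ... | no 1+n∉v  = contradiction (pigeonhole n v uniq (InRange-without-max n v 1+n∉v range)) (<⇒≱ (≤-reflexive (sym len)))

  ≢max : ∀ n {v} → All (InRange n) v → All (suc n ≢_) v
  ≢max n = All.map (λ (_ , x≤n) 1+n≡x → <⇒≱ (s≤s x≤n) (≤-reflexive 1+n≡x))

  ∈-Sym-suc⁻ : ∀ n {v} → v ∈ Sym (suc n) → v ∈ concatMap (insertions (suc n)) (Sym n)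
  ∈-Sym-suc⁻ n {v} v∈ = ∈-concatMap⁺ (insertions (suc n)) (lose w∈ (insertions-delete (suc n) v 1+n∈v))
    where
    perm = ∈-Sym⁻ (suc n) v∈
    1+n∈v = max∈permutation n v perm
    uniq = proj₂ (proj₂ perm)
    w∈ : delete (suc n) v ∈ Sym n
    w∈ = ∈-Sym⁺ n ( suc-injective (trans (sym (length-delete (suc n) v 1+n∈v)) (proj₁ perm))
                  , InRange-delete-max n v uniq (proj₁ (proj₂ perm))
                  , Unique-delete (suc n) v uniq )

  ∈-Sym-suc⁺ : ∀ n {v} → v ∈ concatMap (insertions (suc n)) (Sym n) → v ∈ Sym (suc n)
  ∈-Sym-suc⁺ n v∈ with find (∈-concatMap⁻ (insertions (suc n)) {xs = Sym n} v∈)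
  ... | w , w∈ , v∈w with ∈-Sym⁻ n w∈
  ...   | len , range , uniq =
    ∈-Sym⁺ (suc n) ( trans (length-∈-insertions (suc n) w v∈w) (cong suc len)
                   , All-∈-insertions (suc n) w (s≤s z≤n , ≤-refl) (All.map (λ (0<x , x≤n) → 0<x , m≤n⇒m≤1+n x≤n) range) v∈w
                   , Unique-∈-insertions (suc n) w (≢max n range) uniq v∈w )

  Sym-suc↭ : ∀ n → Sym (suc n) ↭ concatMap (insertions (suc n)) (Sym n)
  Sym-suc↭ n = ∼bag⇒↭ (unique∧set⇒bag (Sym-unique (suc n))
    (concatMap-insertions-unique (suc n) (Sym n) (Sym-unique n) (All.tabulate (λ w∈ → ≢max n (proj₁ (proj₂ (∈-Sym⁻ n w∈))))))
    (mk⇔ (∈-Sym-suc⁻ n) (∈-Sym-suc⁺ n)))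

  count-∷ : ∀ {A : Set} (p : A → Bool) x xs → count p (x ∷ xs) ≡ χ (p x) + count p xs
  count-∷ p x xs with p x
  ... | true  = refl
  ... | false = refl

  count-map : ∀ {A B : Set} (p : B → Bool) (f : A → B) xs → count p (map f xs) ≡ count (p ∘ f) xs
  count-map p f []       = refl
  count-map p f (x ∷ xs) = trans (count-∷ p (f x) (map f xs))
                                 (trans (cong (χ (p (f x)) +_) (count-map p f xs)) (sym (count-∷ (p ∘ f) x xs)))

  count-++ : ∀ {A : Set} (p : A → Bool) xs ys → count p (xs ++ ys) ≡ count p xs + count p ys
  count-++ p xs ys = trans (cong length (filter-++ (T? ∘ p) xs ys)) (length-++ (filterᵇ p xs))

  count-↭ : ∀ {A : Set} (p : A → Bool) {xs ys} → xs ↭ ys → count p xs ≡ count p ys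
  count-↭ p xs↭ys = ↭-length (filter-↭ (T? ∘ p) xs↭ys)

  count-cong : ∀ {A : Set} {p q : A → Bool} xs → (∀ {x} → x ∈ xs → p x ≡ q x) → count p xs ≡ count q xs
  count-cong {p = p} {q} []       _  = refl
  count-cong {p = p} {q} (x ∷ xs) eq =
    trans (count-∷ p x xs) (trans (cong₂ (λ b n → χ b + n) (eq (here refl)) (count-cong xs (eq ∘ there))) (sym (count-∷ q x xs)))

  count-true : ∀ {A : Set} (xs : List A) → count (λ _ → true) xs ≡ length xs
  count-true []       = refl
  count-true (x ∷ xs) = cong suc (count-true xs)

  length-insertions : ∀ M w → length (insertions M w) ≡ suc (length w)
  length-insertions M []      = refl
  length-insertions M (x ∷ w) = cong suc (trans (length-map (x ∷_) (insertions M w)) (length-insertions M w))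

  -- spread P a B c counts the values satisfying P among a copies of B, one
  -- copy of B + 1 and c copies of B + 2.
  spread : (ℕ → Bool) → ℕ → ℕ → ℕ → ℕ
  spread P a B c = a * χ (P B) + χ (P (suc B)) + c * χ (P (suc (suc B)))

  spread-low : ∀ P a B c → χ (P B) + spread P a B c ≡ spread P (suc a) B c
  spread-low P a B c = trans (sym (+-assoc x (a * x + y) z′)) (cong (_+ z′) (sym (+-assoc x (a * x) y)))
    where
    x = χ (P B)
    y = χ (P (suc B))
    z′ = c * χ (P (suc (suc B)))

  spread-high : ∀ P a B c → χ (P (suc (suc B))) + spread P a B c ≡ spread P a B (suc c)
  spread-high P a B c = trans (sym (+-assoc z low (c * z))) (trans (cong (_+ c * z) (+-comm z low)) (+-assoc low z (c * z)))
    where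
    z = χ (P (suc (suc B)))
    low = a * χ (P B) + χ (P (suc B))

  spread-pair : ∀ P B → χ (P (suc B)) + (χ (P B) + 0) ≡ spread P 1 B 0
  spread-pair P B = trans (+-comm (χ (P (suc B))) (χ (P B) + 0)) (sym (+-identityʳ _))

  spread-shift : ∀ P e a B c → spread (λ t → P (e + t)) a B c ≡ spread P a (e + B) c
  spread-shift P e a B c = cong₂ (λ m n → a * χ (P (e + B)) + χ (P m) + c * χ (P n)) (+-suc e B) (trans (+-suc e (suc B)) (cong suc (+-suc e B)))

  turns-max-head : ∀ M d p x xs → p < M → x < M → turns d p (M ∷ x ∷ xs) ≡ χ (not d) + suc (turns false x xs)
  turns-max-head M d p x xs p<M x<M rewrite <ᵇ-true p<M | <ᵇ-false (<⇒≤ x<M) with d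
  ... | true  = refl
  ... | false = refl

  -- Putting the maximum in front of x ∷ y ∷ ys keeps its number of turns or raises it
  -- by two, depending on the directions d, s, s′ of the steps into p, from p to x and
  -- from x to y; the second components relate the multiplicities of the lowest value.
  front-insertion : ∀ d s s′ T →
    let B′ = χ (s xor s′) + T
        B  = χ (d xor s) + B′
        h  = χ (not d) + suc (χ s′ + T)
    in (h ≡ B × χ (d ∧ s) + B ≡ suc (χ (s ∧ s′) + B′)) ⊎ (h ≡ suc (suc B) × χ (d ∧ s) + B ≡ χ (s ∧ s′) + B′)
  front-insertion true  true  true  T = inj₂ (refl , refl)
  front-insertion true  true  false T = inj₁ (refl , refl)
  front-insertion true  false true  T = inj₁ (refl , refl)
  front-insertion true  false false T = inj₁ (refl , refl)
  front-insertion false true  true  T = inj₂ (refl , refl)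
  front-insertion false true  false T = inj₁ (refl , refl)
  front-insertion false false true  T = inj₂ (refl , refl)
  front-insertion false false false T = inj₂ (refl , refl)

  spread-∷ : ∀ {h a a′ B} c′ → (h ≡ B × a ≡ suc a′) ⊎ (h ≡ suc (suc B) × a ≡ a′) →
    Σ ℕ λ c → ∀ P → χ (P h) + spread P a′ B c′ ≡ spread P a B c
  spread-∷ {a′ = a′} {B} c′ (inj₁ (refl , refl)) = c′ , λ P → spread-low P a′ B c′
  spread-∷ {a′ = a′} {B} c′ (inj₂ (refl , refl)) = suc c′ , λ P → spread-high P a′ B c′

  count-insertions-∷ : ∀ (q : List ℕ → Bool) M x xs →
    count q (insertions M (x ∷ xs)) ≡ χ (q (M ∷ x ∷ xs)) + count (λ v → q (x ∷ v)) (insertions M xs)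
  count-insertions-∷ q M x xs = trans (count-∷ q _ _) (cong (χ (q (M ∷ x ∷ xs)) +_) (count-map q (x ∷_) (insertions M xs)))

  count-turns-insertions : ∀ M d p x xs → p < M → All (_< M) (x ∷ xs) →
    Σ ℕ λ c → ∀ P → count (λ v → P (turns d p v)) (insertions M (x ∷ xs))
                    ≡ spread P (χ (d ∧ (p <ᵇ x)) + turns d p (x ∷ xs)) (turns d p (x ∷ xs)) c
  count-turns-insertions M d p x [] p<M (x<M ∷ []) with single (p <ᵇ x) d
    where
    single : ∀ s d → Σ ℕ λ c → ∀ P → χ (P (χ (not d) + 1)) + (χ (P (χ (d xor s) + (χ (s xor true) + 0))) + 0)
                                    ≡ spread P (χ (d ∧ s) + (χ (d xor s) + 0)) (χ (d xor s) + 0) c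
    single true  true  = 0 , λ P → spread-pair P 0
    single false true  = 0 , λ P → spread-low P 0 1 0
    single true  false = 0 , λ P → spread-pair P 1
    single false false = 1 , λ P → spread-high P 0 0 0
  ... | c , values = c , λ P → begin
    count (λ v → P (turns d p v)) (insertions M (x ∷ []))
      ≡⟨ trans (count-insertions-∷ (λ v → P (turns d p v)) M x [])
               (cong (χ (P (turns d p (M ∷ x ∷ []))) +_) (count-∷ (λ v → P (turns d p (x ∷ v))) (M ∷ []) [])) ⟩
    χ (P (turns d p (M ∷ x ∷ []))) + (χ (P (turns d p (x ∷ M ∷ []))) + 0)
      ≡⟨ cong₂ (λ h t → χ (P h) + (χ (P (χ (d xor (p <ᵇ x)) + (χ ((p <ᵇ x) xor t) + 0))) + 0))
               (turns-max-head M d p x [] p<M x<M) (<ᵇ-true x<M) ⟩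
    χ (P (χ (not d) + 1)) + (χ (P (χ (d xor (p <ᵇ x)) + (χ ((p <ᵇ x) xor true) + 0))) + 0)
      ≡⟨ values P ⟩
    spread P (χ (d ∧ (p <ᵇ x)) + turns d p (x ∷ [])) (turns d p (x ∷ [])) c ∎
    where open ≡-Reasoning
  count-turns-insertions M d p x (y ∷ xs) p<M (x<M ∷ y<M ∷ xs<M)
    with count-turns-insertions M (p <ᵇ x) x y xs x<M (y<M ∷ xs<M)
  ... | c′ , ih with spread-∷ c′ (front-insertion d (p <ᵇ x) (x <ᵇ y) (turns (x <ᵇ y) y xs))
  ... | c , add-front = c , λ P → begin
    count (λ v → P (turns d p v)) (insertions M (x ∷ y ∷ xs))
      ≡⟨ count-insertions-∷ (λ v → P (turns d p v)) M x (y ∷ xs) ⟩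
    χ (P (turns d p (M ∷ x ∷ y ∷ xs))) + count (λ v → P (e + turns (p <ᵇ x) x v)) (insertions M (y ∷ xs))
      ≡⟨ cong₂ _+_ (cong (χ ∘ P) (turns-max-head M d p x (y ∷ xs) p<M x<M))
                   (trans (ih (λ t → P (e + t))) (spread-shift P e a′ B′ c′)) ⟩
    χ (P (χ (not d) + suc (turns false x (y ∷ xs)))) + spread P a′ (e + B′) c′
      ≡⟨ add-front P ⟩
    spread P (χ (d ∧ (p <ᵇ x)) + turns d p (x ∷ y ∷ xs)) (turns d p (x ∷ y ∷ xs)) c ∎
    where
    open ≡-Reasoning
    e = χ (d xor (p <ᵇ x))
    B′ = turns (p <ᵇ x) x (y ∷ xs)
    a′ = χ ((p <ᵇ x) ∧ (x <ᵇ y)) + B′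

  <ᵇ-∸2 : ∀ t k → (t <ᵇ k ∸ 2) ≡ (suc (suc t) <ᵇ k)
  <ᵇ-∸2 t zero          = refl
  <ᵇ-∸2 t (suc zero)    = refl
  <ᵇ-∸2 t (suc (suc k)) = refl

  threshold-identity : ∀ t c k →
    spread (_<ᵇ k) (suc t) t c + k * χ (suc (suc t) <ᵇ k)
      ≡ k * χ (t <ᵇ k) + (suc (suc t) + c) * χ (suc (suc t) <ᵇ k)
  threshold-identity t       c zero                = empty t c
    where
    empty : ∀ t c → suc t * 0 + 0 + c * 0 + 0 * 0 ≡ 0 * 0 + (suc (suc t) + c) * 0
    empty = solve-∀
  threshold-identity zero    c (suc zero)          = one c
    where
    one : ∀ c → 1 * 1 + 0 + c * 0 + 1 * 0 ≡ 1 * 1 + (2 + c) * 0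
    one = solve-∀
  threshold-identity zero    c (suc (suc zero))    = two c
    where
    two : ∀ c → 1 * 1 + 1 + c * 0 + 2 * 0 ≡ 2 * 1 + (2 + c) * 0
    two = solve-∀
  threshold-identity zero    c (suc (suc (suc k))) = all c k
    where
    all : ∀ c k → 1 * 1 + 1 + c * 1 + suc (suc (suc k)) * 1 ≡ suc (suc (suc k)) * 1 + (2 + c) * 1
    all = solve-∀
  threshold-identity (suc t) c (suc k)             =
    shift (χ (t <ᵇ k)) (χ (suc t <ᵇ k)) (χ (suc (suc t) <ᵇ k)) (threshold-identity t c k)
    where
    regroup : ∀ X Y Z t c k → suc (suc t) * X + Y + c * Z + suc k * Z ≡ (suc t * X + Y + c * Z + k * Z) + (X + Z)
    regroup = solve-∀
    regroup′ : ∀ X Z t c k → (k * X + (suc (suc t) + c) * Z) + (X + Z) ≡ suc k * X + (suc (suc (suc t)) + c) * Z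
    regroup′ = solve-∀
    shift : ∀ X Y Z → suc t * X + Y + c * Z + k * Z ≡ k * X + (suc (suc t) + c) * Z →
            suc (suc t) * X + Y + c * Z + suc k * Z ≡ suc k * X + (suc (suc (suc t)) + c) * Z
    shift X Y Z ih = trans (regroup X Y Z t c k) (trans (cong (_+ (X + Z)) ih) (regroup′ X Z t c k))

  count-concatMap-linear : ∀ {A B : Set} (f : A → List B) (p : B → Bool) (q r : A → Bool) k m xs →
    (∀ {x} → x ∈ xs → count p (f x) + k * χ (q x) ≡ k * χ (r x) + m * χ (q x)) →
    count p (concatMap f xs) + k * count q xs ≡ k * count r xs + m * count q xs
  count-concatMap-linear f p q r k m []       _    = trans (*-zeroʳ k) (sym (cong₂ _+_ (*-zeroʳ k) (*-zeroʳ m)))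
  count-concatMap-linear f p q r k m (x ∷ xs) each = begin
    count p (f x ++ concatMap f xs) + k * count q (x ∷ xs)
      ≡⟨ cong₂ (λ u v → u + k * v) (count-++ p (f x) (concatMap f xs)) (count-∷ q x xs) ⟩
    (F + Fs) + k * (Q + Qs)          ≡⟨ regroup F Fs Q Qs k ⟩
    (F + k * Q) + (Fs + k * Qs)      ≡⟨ cong₂ _+_ (each (here refl)) (count-concatMap-linear f p q r k m xs (each ∘ there)) ⟩
    (k * R + m * Q) + (k * Rs + m * Qs) ≡⟨ regroup′ R Rs Q Qs k m ⟩
    k * (R + Rs) + m * (Q + Qs)
      ≡⟨ cong₂ (λ u v → k * u + m * v) (count-∷ r x xs) (count-∷ q x xs) ⟨
    k * count r (x ∷ xs) + m * count q (x ∷ xs) ∎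
    where
    open ≡-Reasoning
    F = count p (f x)
    Fs = count p (concatMap f xs)
    Q = χ (q x)
    Qs = count q xs
    R = χ (r x)
    Rs = count r xs
    regroup : ∀ F Fs Q Qs k → (F + Fs) + k * (Q + Qs) ≡ (F + k * Q) + (Fs + k * Qs)
    regroup = solve-∀
    regroup′ : ∀ R Rs Q Qs k m → (k * R + m * Q) + (k * Rs + m * Qs) ≡ k * (R + Rs) + m * (Q + Qs)
    regroup′ = solve-∀

  count-as-insertions : ∀ n k w → 1 ≤ n → w ∈ Sym n →
    count (λ v → as v <ᵇ suc k) (insertions (suc n) w) + k * χ (as w <ᵇ suc (k ∸ 2))
      ≡ k * χ (as w <ᵇ suc k) + suc n * χ (as w <ᵇ suc (k ∸ 2))
  count-as-insertions n k w 1≤n w∈ with ∈-Sym⁻ n w∈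
  count-as-insertions n k []            (s≤s z≤n) _ | () , _ , _
  count-as-insertions n k (zero ∷ xs)   _         _ | _ , ((() , _) ∷ _) , _
  count-as-insertions n k (suc x ∷ xs)  _         _ | len , range , uniq
    with count-turns-insertions (suc n) true 0 (suc x) xs (s≤s z≤n) (All.map (λ (_ , y≤n) → s≤s y≤n) range)
  ... | c , values = begin
    count (λ v → as v <ᵇ suc k) (insertions (suc n) w) + k * χ (as w <ᵇ suc (k ∸ 2))
      ≡⟨ cong₂ (λ u v → u + k * χ (v <ᵇ suc (k ∸ 2))) (trans (count-cong (insertions (suc n) w) as<ᵇ) (values (_<ᵇ k))) asw ⟩
    spread (_<ᵇ k) (suc t) t c + k * χ (t <ᵇ k ∸ 2)
      ≡⟨ cong (λ b → spread (_<ᵇ k) (suc t) t c + k * χ b) (<ᵇ-∸2 t k) ⟩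
    spread (_<ᵇ k) (suc t) t c + k * χ (suc (suc t) <ᵇ k)
      ≡⟨ threshold-identity t c k ⟩
    k * χ (t <ᵇ k) + (suc (suc t) + c) * χ (suc (suc t) <ᵇ k)
      ≡⟨ cong₂ (λ u b → k * χ (t <ᵇ k) + u * χ b) size (sym (<ᵇ-∸2 t k)) ⟩
    k * χ (t <ᵇ k) + suc n * χ (t <ᵇ k ∸ 2)
      ≡⟨ cong (λ v → k * χ (v <ᵇ suc k) + suc n * χ (v <ᵇ suc (k ∸ 2))) asw ⟨
    k * χ (as w <ᵇ suc k) + suc n * χ (as w <ᵇ suc (k ∸ 2)) ∎
    where
    open ≡-Reasoning
    w = suc x ∷ xs
    t = turns true 0 w
    positive : All (0 <_) w
    positive = All.map proj₁ range
    asw : as w ≡ suc t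
    asw = as≡suc-turns (suc x) xs positive uniq
    as<ᵇ : ∀ {v} → v ∈ insertions (suc n) w → (as v <ᵇ suc k) ≡ (turns true 0 v <ᵇ k)
    as<ᵇ {[]}     v∈ = contradiction (length-∈-insertions (suc n) w v∈) λ ()
    as<ᵇ {y ∷ ys} v∈ = cong (_<ᵇ suc k) (as≡suc-turns y ys (All-∈-insertions (suc n) w (s≤s z≤n) positive v∈)
                                                           (Unique-∈-insertions (suc n) w (≢max n range) uniq v∈))
    size : suc (suc t) + c ≡ suc n
    size = begin
      suc (suc t) + c                          ≡⟨ total t c ⟩
      spread (λ _ → true) (suc t) t c          ≡⟨ values (λ _ → true) ⟨
      count (λ _ → true) (insertions (suc n) w) ≡⟨ count-true (insertions (suc n) w) ⟩
      length (insertions (suc n) w)            ≡⟨ length-insertions (suc n) w ⟩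
      suc (length w)                           ≡⟨ cong suc len ⟩
      suc n                                    ∎
      where
      total : ∀ t c → suc (suc t) + c ≡ suc t * 1 + 1 + c * 1
      total = solve-∀

  b-suc : ∀ k n → 1 ≤ n → b k (suc n) + k * b (k ∸ 2) n ≡ k * b k n + suc n * b (k ∸ 2) n
  b-suc k n 1≤n = begin
    count below-k (Sym (suc n)) + k * b (k ∸ 2) n
      ≡⟨ cong (_+ k * b (k ∸ 2) n) (count-↭ below-k (Sym-suc↭ n)) ⟩
    count below-k (concatMap (insertions (suc n)) (Sym n)) + k * b (k ∸ 2) n
      ≡⟨ count-concatMap-linear (insertions (suc n)) below-k _ below-k k (suc n) (Sym n)
                                (λ {w} → count-as-insertions n k w 1≤n) ⟩
    k * b k n + suc n * b (k ∸ 2) n ∎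
    where
    open ≡-Reasoning
    below-k : List ℕ → Bool
    below-k v = as v <ᵇ suc k

  b-zero : ∀ n → 1 ≤ n → b 0 n ≡ 0
  b-zero n 1≤n = trans (count-cong (Sym n) as≥1) (count-false (Sym n))
    where
    as≥1 : ∀ {w} → w ∈ Sym n → (as w <ᵇ 1) ≡ false
    as≥1 {w} w∈ with ∈-Sym⁻ n w∈
    as≥1 {[]}    _ | len , _ , _         = contradiction len (<⇒≢ 1≤n)
    as≥1 {y ∷ ys} _ | _ , range , uniq rewrite as≡suc-turns y ys (All.map proj₁ range) uniq = refl
    count-false : ∀ (ws : List (List ℕ)) → count (λ _ → false) ws ≡ 0
    count-false []       = refl
    count-false (_ ∷ ws) = count-false ws

  b-one : ∀ n → b 1 (suc n) ≡ 1
  b-one zero    = refl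
  b-one (suc n) = begin
    b 1 (suc (suc n))                           ≡⟨ +-identityʳ _ ⟨
    b 1 (suc (suc n)) + 1 * 0                   ≡⟨ cong (λ z → b 1 (suc (suc n)) + 1 * z) (b-zero (suc n) (s≤s z≤n)) ⟨
    b 1 (suc (suc n)) + 1 * b 0 (suc n)         ≡⟨ b-suc 1 (suc n) (s≤s z≤n) ⟩
    1 * b 1 (suc n) + suc (suc n) * b 0 (suc n) ≡⟨ cong₂ (λ u z → 1 * u + suc (suc n) * z) (b-one n) (b-zero (suc n) (s≤s z≤n)) ⟩
    1 + suc (suc n) * 0                         ≡⟨ cong suc (*-zeroʳ (suc (suc n))) ⟩
    1                                           ∎
    where open ≡-Reasoning

  χ≡ᵇ+χ<ᵇ : ∀ r k → χ (r ≡ᵇ suc k) + χ (r <ᵇ suc k) ≡ χ (r <ᵇ suc (suc k))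
  χ≡ᵇ+χ<ᵇ zero          k       = refl
  χ≡ᵇ+χ<ᵇ (suc zero)    zero    = refl
  χ≡ᵇ+χ<ᵇ (suc (suc r)) zero    = refl
  χ≡ᵇ+χ<ᵇ (suc r)       (suc k) = χ≡ᵇ+χ<ᵇ r k

  count-+ : ∀ {A : Set} (p q r : A → Bool) → (∀ x → χ (p x) + χ (q x) ≡ χ (r x)) →
    ∀ xs → count p xs + count q xs ≡ count r xs
  count-+ p q r pointwise []       = refl
  count-+ p q r pointwise (x ∷ xs) = begin
    count p (x ∷ xs) + count q (x ∷ xs)              ≡⟨ cong₂ _+_ (count-∷ p x xs) (count-∷ q x xs) ⟩
    (χ (p x) + count p xs) + (χ (q x) + count q xs)  ≡⟨ interchange (χ (p x)) (count p xs) (χ (q x)) (count q xs) ⟩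
    (χ (p x) + χ (q x)) + (count p xs + count q xs)  ≡⟨ cong₂ _+_ (pointwise x) (count-+ p q r pointwise xs) ⟩
    χ (r x) + count r xs                             ≡⟨ count-∷ r x xs ⟨
    count r (x ∷ xs)                                 ∎
    where
    open ≡-Reasoning
    interchange : ∀ a b c d → (a + b) + (c + d) ≡ (a + c) + (b + d)
    interchange = solve-∀

  a+b≡b : ∀ k n → a (suc k) n + b k n ≡ b (suc k) n
  a+b≡b k n = count-+ _ _ _ (λ w → χ≡ᵇ+χ<ᵇ (as w) k) (Sym n)

module ClosedForm where
  open import Data.Bool using (true; false; _∧_; if_then_else_)
  open import Data.Bool.Properties using (∧-zeroʳ; ∧-identityʳ)
  open import Data.List using (List; []; _∷_; _++_; map; concatMap; upTo; applyUpTo)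
  open import Data.Nat.DivMod using (_%_; _/_; [m+kn]%n≡m%n; m*n/n≡m; m%n<n; m≡m%n+[m/n]*n)
  open import Data.Integer using (ℤ; +_; -_; _+_; _*_; _-_)
  import Data.Integer.Properties as ℤ
  open import Data.Integer.Tactic.RingSolver using (solve-∀)
  import Data.Nat as ℕ
  open ℕ using (ℕ; zero; suc; _∸_; _≤_; _<_; z≤n; s≤s; _^_; _≡ᵇ_; _<ᵇ_)
  import Data.Nat.Properties as ℕₚ
  import Data.Nat.Tactic.RingSolver as ℕ-Solver
  open import Data.Nat.Combinatorics using (_C_; nCk+nC[k+1]≡[n+1]C[k+1]; nCk≡nC[n∸k]; nCn≡1; nC1≡n; k>n⇒nCk≡0)
  open import Function using (_∘_; id)
  open import Data.Product using (∃₂; _×_; _,_; proj₁; proj₂)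
  open import Relation.Binary.PropositionalEquality hiding (J)
  open import Algebra.Bundles using (AbelianGroup)
  open import Algebra.Properties.Group (AbelianGroup.group ℤ.+-0-abelianGroup) using () renaming (∙-cancelʳ to +-cancelʳ)

  open Combinatorics using (≡ᵇ-refl; b-suc; b-zero; b-one; a+b≡b)

  -- Binomial coefficients and finite sums

  pascal : ∀ n k → suc n C suc k ≡ n C k ℕ.+ n C suc k
  pascal n k = sym (nCk+nC[k+1]≡[n+1]C[k+1] n k)

  C-absorb : ∀ n k → suc k ℕ.* (suc n C suc k) ≡ suc n ℕ.* (n C k)
  C-absorb zero    zero    = refl
  C-absorb zero    (suc k) = ℕₚ.*-zeroʳ (suc (suc k))
  C-absorb (suc n) zero    = trans (ℕₚ.+-identityʳ _) (trans (nC1≡n (suc (suc n))) (sym (ℕₚ.*-identityʳ _)))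
  C-absorb (suc n) (suc k) = begin
    suc (suc k) ℕ.* (suc (suc n) C suc (suc k))
      ≡⟨ cong (suc (suc k) ℕ.*_) (pascal (suc n) (suc k)) ⟩
    suc (suc k) ℕ.* (suc n C suc k ℕ.+ suc n C suc (suc k))
      ≡⟨ split (suc k) (suc n C suc k) (suc n C suc (suc k)) ⟩
    suc k ℕ.* (suc n C suc k) ℕ.+ suc n C suc k ℕ.+ suc (suc k) ℕ.* (suc n C suc (suc k))
      ≡⟨ cong₂ (λ u v → u ℕ.+ suc n C suc k ℕ.+ v) (C-absorb n k) (C-absorb n (suc k)) ⟩
    suc n ℕ.* (n C k) ℕ.+ suc n C suc k ℕ.+ suc n ℕ.* (n C suc k)
      ≡⟨ cong (λ u → suc n ℕ.* (n C k) ℕ.+ u ℕ.+ suc n ℕ.* (n C suc k)) (pascal n k) ⟩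
    suc n ℕ.* (n C k) ℕ.+ (n C k ℕ.+ n C suc k) ℕ.+ suc n ℕ.* (n C suc k)
      ≡⟨ merge (suc n) (n C k) (n C suc k) ⟩
    suc (suc n) ℕ.* (n C k ℕ.+ n C suc k)
      ≡⟨ cong (suc (suc n) ℕ.*_) (pascal n k) ⟨
    suc (suc n) ℕ.* (suc n C suc k)
      ∎
    where
    open ≡-Reasoning
    split : ∀ k a b → suc k ℕ.* (a ℕ.+ b) ≡ k ℕ.* a ℕ.+ a ℕ.+ suc k ℕ.* b
    split = ℕ-Solver.solve-∀
    merge : ∀ m a b → m ℕ.* a ℕ.+ (a ℕ.+ b) ℕ.+ m ℕ.* b ≡ suc m ℕ.* (a ℕ.+ b)
    merge = ℕ-Solver.solve-∀

  C-sym : ∀ a b → (a ℕ.+ b) C a ≡ (a ℕ.+ b) C b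
  C-sym a b = trans (nCk≡nC[n∸k] (ℕₚ.m≤m+n a b)) (cong ((a ℕ.+ b) C_) (ℕₚ.m+n∸m≡n a b))

  C-absorb-top : ∀ a d → suc d ℕ.* (suc (a ℕ.+ d) C a) ≡ suc (a ℕ.+ d) ℕ.* ((a ℕ.+ d) C a)
  C-absorb-top a d = begin
    suc d ℕ.* (suc (a ℕ.+ d) C a)       ≡⟨ cong (λ m → suc d ℕ.* (m C a)) (ℕₚ.+-suc a d) ⟨
    suc d ℕ.* ((a ℕ.+ suc d) C a)       ≡⟨ cong (suc d ℕ.*_) (C-sym a (suc d)) ⟩
    suc d ℕ.* ((a ℕ.+ suc d) C suc d)   ≡⟨ cong (λ m → suc d ℕ.* (m C suc d)) (ℕₚ.+-suc a d) ⟩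
    suc d ℕ.* (suc (a ℕ.+ d) C suc d)   ≡⟨ C-absorb (a ℕ.+ d) d ⟩
    suc (a ℕ.+ d) ℕ.* ((a ℕ.+ d) C d)   ≡⟨ cong (suc (a ℕ.+ d) ℕ.*_) (C-sym a d) ⟨
    suc (a ℕ.+ d) ℕ.* ((a ℕ.+ d) C a)   ∎
    where open ≡-Reasoning

  [1+n]Cn≡1+n : ∀ n → suc n C n ≡ suc n
  [1+n]Cn≡1+n n = trans (sym (C-sym 1 n)) (nC1≡n (suc n))

  ∑ : ℕ → (ℕ → ℤ) → ℤ
  ∑ zero    f = + 0
  ∑ (suc N) f = f 0 + ∑ N (f ∘ suc)

  infixl 10 ∑
  syntax ∑ N (λ i → f) = ∑[ i < N ] f

  ∑-cong : ∀ N {f g : ℕ → ℤ} → (∀ i → i < N → f i ≡ g i) → ∑ N f ≡ ∑ N g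
  ∑-cong zero    eq = refl
  ∑-cong (suc N) eq = cong₂ _+_ (eq 0 (s≤s z≤n)) (∑-cong N (λ i i<N → eq (suc i) (s≤s i<N)))

  ∑-zero : ∀ N → ∑[ i < N ] (+ 0) ≡ + 0
  ∑-zero zero    = refl
  ∑-zero (suc N) = trans (ℤ.+-identityˡ _) (∑-zero N)

  ∑-+ : ∀ N (f g : ℕ → ℤ) → ∑[ i < N ] (f i + g i) ≡ ∑ N f + ∑ N g
  ∑-+ zero    f g = refl
  ∑-+ (suc N) f g = trans (cong (_+_ (f 0 + g 0)) (∑-+ N (f ∘ suc) (g ∘ suc))) (interchange (f 0) (g 0) _ _)
    where
    interchange : ∀ a b c d → a + b + (c + d) ≡ a + c + (b + d)
    interchange = solve-∀

  ∑-*ˡ : ∀ N c (f : ℕ → ℤ) → ∑[ i < N ] (c * f i) ≡ c * ∑ N f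
  ∑-*ˡ zero    c f = sym (ℤ.*-zeroʳ c)
  ∑-*ˡ (suc N) c f = trans (cong (_+_ (c * f 0)) (∑-*ˡ N c (f ∘ suc))) (sym (ℤ.*-distribˡ-+ c (f 0) _))

  ∑-*ʳ : ∀ N (f : ℕ → ℤ) c → ∑[ i < N ] (f i * c) ≡ ∑ N f * c
  ∑-*ʳ N f c = trans (∑-cong N (λ i _ → ℤ.*-comm (f i) c)) (trans (∑-*ˡ N c f) (ℤ.*-comm c (∑ N f)))

  ∑-last : ∀ N (f : ℕ → ℤ) → ∑ (suc N) f ≡ ∑ N f + f N
  ∑-last zero    f = trans (ℤ.+-identityʳ (f 0)) (sym (ℤ.+-identityˡ (f 0)))
  ∑-last (suc N) f = trans (cong (_+_ (f 0)) (∑-last N (f ∘ suc))) (sym (ℤ.+-assoc (f 0) _ _))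

  -- Q A m n is the coefficient of x^m in (1 - 2x)^n / (1 - x)^(A + 1).

  q : ℕ → ℕ → ℕ → ℕ → ℤ
  q A m n s = (- + 2) ^ℤ s * + (((A ℕ.+ (m ∸ s)) C A) ℕ.* (n C s))

  Q : ℕ → ℕ → ℕ → ℤ
  Q A m n = ∑ (suc m) (q A m n)

  Q-suc-suc : ∀ A m n → Q A (suc m) (suc n) ≡ Q A (suc m) n - + 2 * Q A m n
  Q-suc-suc A m n = begin
    q₀ + ∑ (suc m) (q A (suc m) (suc n) ∘ suc)
      ≡⟨ cong (_+_ q₀) (∑-cong (suc m) (λ s _ → pascal-term s)) ⟩
    q₀ + ∑[ s < suc m ] (q A (suc m) n (suc s) + (- + 2) * q A m n s)
      ≡⟨ cong (_+_ q₀) (∑-+ (suc m) (q A (suc m) n ∘ suc) (λ s → (- + 2) * q A m n s)) ⟩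
    q₀ + (∑ (suc m) (q A (suc m) n ∘ suc) + ∑[ s < suc m ] ((- + 2) * q A m n s))
      ≡⟨ cong (λ z → q₀ + (∑ (suc m) (q A (suc m) n ∘ suc) + z)) (∑-*ˡ (suc m) (- + 2) (q A m n)) ⟩
    q₀ + (∑ (suc m) (q A (suc m) n ∘ suc) + (- + 2) * Q A m n)
      ≡⟨ regroup q₀ _ (Q A m n) ⟩
    Q A (suc m) n - + 2 * Q A m n
      ∎
    where
    open ≡-Reasoning
    q₀ = q A (suc m) n 0
    regroup : ∀ a b c → a + (b + (- + 2) * c) ≡ a + b - + 2 * c
    regroup = solve-∀
    distribute : ∀ p b x y → (- + 2) * p * (b * (x + y)) ≡ (- + 2) * p * (b * y) + (- + 2) * (p * (b * x))
    distribute = solve-∀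
    pascal-term : ∀ s → q A (suc m) (suc n) (suc s) ≡ q A (suc m) n (suc s) + (- + 2) * q A m n s
    pascal-term s = begin
      (- + 2) ^ℤ suc s * + (B ℕ.* (suc n C suc s))
        ≡⟨ cong (λ c → (- + 2) ^ℤ suc s * + (B ℕ.* c)) (pascal n s) ⟩
      (- + 2) ^ℤ suc s * + (B ℕ.* (n C s ℕ.+ n C suc s))
        ≡⟨ cong ((- + 2) ^ℤ suc s *_) (trans (ℤ.pos-* B _) (cong (+ B *_) (ℤ.pos-+ (n C s) (n C suc s)))) ⟩
      (- + 2) * (- + 2) ^ℤ s * (+ B * (+ (n C s) + + (n C suc s)))
        ≡⟨ distribute ((- + 2) ^ℤ s) (+ B) (+ (n C s)) (+ (n C suc s)) ⟩
      (- + 2) * (- + 2) ^ℤ s * (+ B * + (n C suc s)) + (- + 2) * ((- + 2) ^ℤ s * (+ B * + (n C s)))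
        ≡⟨ cong₂ (λ u v → (- + 2) * (- + 2) ^ℤ s * u + (- + 2) * ((- + 2) ^ℤ s * v)) (ℤ.pos-* B _) (ℤ.pos-* B _) ⟨
      (- + 2) ^ℤ suc s * + (B ℕ.* (n C suc s)) + (- + 2) * ((- + 2) ^ℤ s * + (B ℕ.* (n C s)))
        ∎
      where
      B = (A ℕ.+ (m ∸ s)) C A

  Q-zeroᵐ : ∀ A n → Q A 0 n ≡ + 1
  Q-zeroᵐ A n = trans (ℤ.+-identityʳ _) (trans (ℤ.*-identityˡ _)
    (cong +_ (trans (ℕₚ.*-identityʳ _) (trans (cong (_C A) (ℕₚ.+-identityʳ A)) (nCn≡1 A)))))

  Q-zeroⁿ : ∀ A m → Q A m 0 ≡ + ((A ℕ.+ m) C A)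
  Q-zeroⁿ A m = begin
    q A m 0 0 + ∑ m (q A m 0 ∘ suc)      ≡⟨ cong₂ _+_ first (trans (∑-cong m (λ s _ → vanish s)) (∑-zero m)) ⟩
    + ((A ℕ.+ m) C A) + + 0              ≡⟨ ℤ.+-identityʳ _ ⟩
    + ((A ℕ.+ m) C A)                    ∎
    where
    open ≡-Reasoning
    first : q A m 0 0 ≡ + ((A ℕ.+ m) C A)
    first = trans (ℤ.*-identityˡ _) (cong +_ (ℕₚ.*-identityʳ _))
    vanish : ∀ s → q A m 0 (suc s) ≡ + 0
    vanish s = trans (cong ((- + 2) ^ℤ suc s *_) (cong +_ (ℕₚ.*-zeroʳ ((A ℕ.+ (m ∸ suc s)) C A)))) (ℤ.*-zeroʳ ((- + 2) ^ℤ suc s))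

  Q-one : ∀ A n → Q A 1 n ≡ + suc A - + 2 * + n
  Q-one A n = begin
    q A 1 n 0 + (q A 1 n 1 + + 0)           ≡⟨ cong₂ (λ u v → u + (v + + 0)) first second ⟩
    + suc A + ((- + 2) * + 1 * (+ 1 * + n) + + 0) ≡⟨ simplify (+ suc A) (+ n) ⟩
    + suc A - + 2 * + n                     ∎
    where
    open ≡-Reasoning
    AC0 : (A ℕ.+ 0) C A ≡ 1
    AC0 = trans (cong (_C A) (ℕₚ.+-identityʳ A)) (nCn≡1 A)
    first : q A 1 n 0 ≡ + suc A
    first = trans (ℤ.*-identityˡ _) (cong +_ (trans (ℕₚ.*-identityʳ _)
              (trans (cong (_C A) (ℕₚ.+-comm A 1)) ([1+n]Cn≡1+n A))))
    second : q A 1 n 1 ≡ (- + 2) * + 1 * (+ 1 * + n)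
    second = cong ((- + 2) * + 1 *_) (trans (ℤ.pos-* ((A ℕ.+ 0) C A) (n C 1)) (cong₂ (λ u v → + u * + v) AC0 (nC1≡n n)))
    simplify : ∀ a x → a + ((- + 2) * + 1 * (+ 1 * x) + + 0) ≡ a - + 2 * x
    simplify = solve-∀

  Q-pascal : ∀ n B j → Q (suc B) (suc j) n ≡ Q B (suc j) n + Q (suc B) j n
  Q-pascal zero    B j = begin
    Q (suc B) (suc j) 0                                  ≡⟨ Q-zeroⁿ (suc B) (suc j) ⟩
    + (suc (B ℕ.+ suc j) C suc B)                        ≡⟨ cong +_ (pascal (B ℕ.+ suc j) B) ⟩
    + ((B ℕ.+ suc j) C B ℕ.+ (B ℕ.+ suc j) C suc B)      ≡⟨ ℤ.pos-+ ((B ℕ.+ suc j) C B) _ ⟩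
    + ((B ℕ.+ suc j) C B) + + ((B ℕ.+ suc j) C suc B)    ≡⟨ cong₂ _+_ (Q-zeroⁿ B (suc j)) (cong (λ m → + (m C suc B)) (sym (ℕₚ.+-suc B j))) ⟨
    Q B (suc j) 0 + + (suc (B ℕ.+ j) C suc B)            ≡⟨ cong (_+_ (Q B (suc j) 0)) (Q-zeroⁿ (suc B) j) ⟨
    Q B (suc j) 0 + Q (suc B) j 0                        ∎
    where open ≡-Reasoning
  Q-pascal (suc n) B zero = begin
    Q (suc B) 1 (suc n)                        ≡⟨ Q-suc-suc (suc B) 0 n ⟩
    Q (suc B) 1 n - + 2 * Q (suc B) 0 n        ≡⟨ cong₂ (λ u v → u - + 2 * v) (Q-pascal n B 0) (Q-zeroᵐ (suc B) n) ⟩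
    Q B 1 n + Q (suc B) 0 n - + 2 * + 1        ≡⟨ cong (λ v → Q B 1 n + v - + 2 * + 1) (Q-zeroᵐ (suc B) n) ⟩
    Q B 1 n + + 1 - + 2 * + 1                  ≡⟨ regroup (Q B 1 n) ⟩
    Q B 1 n - + 2 * + 1 + + 1                  ≡⟨ cong₂ (λ u v → Q B 1 n - + 2 * u + v) (Q-zeroᵐ B n) (Q-zeroᵐ (suc B) (suc n)) ⟨
    Q B 1 n - + 2 * Q B 0 n + Q (suc B) 0 (suc n) ≡⟨ cong (_+ Q (suc B) 0 (suc n)) (Q-suc-suc B 0 n) ⟨
    Q B 1 (suc n) + Q (suc B) 0 (suc n)        ∎
    where
    open ≡-Reasoning
    regroup : ∀ x → x + + 1 - + 2 * + 1 ≡ x - + 2 * + 1 + + 1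
    regroup = solve-∀
  Q-pascal (suc n) B (suc j) = begin
    Q (suc B) (suc (suc j)) (suc n)
      ≡⟨ Q-suc-suc (suc B) (suc j) n ⟩
    Q (suc B) (suc (suc j)) n - + 2 * Q (suc B) (suc j) n
      ≡⟨ cong₂ (λ u v → u - + 2 * v) (Q-pascal n B (suc j)) (Q-pascal n B j) ⟩
    (Q B (suc (suc j)) n + Q (suc B) (suc j) n) - + 2 * (Q B (suc j) n + Q (suc B) j n)
      ≡⟨ regroup (Q B (suc (suc j)) n) (Q (suc B) (suc j) n) (Q B (suc j) n) (Q (suc B) j n) ⟩
    (Q B (suc (suc j)) n - + 2 * Q B (suc j) n) + (Q (suc B) (suc j) n - + 2 * Q (suc B) j n)
      ≡⟨ cong₂ _+_ (Q-suc-suc B (suc j) n) (Q-suc-suc (suc B) j n) ⟨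
    Q B (suc (suc j)) (suc n) + Q (suc B) (suc j) (suc n)
      ∎
    where
    open ≡-Reasoning
    regroup : ∀ a b c d → (a + b) - + 2 * (c + d) ≡ (a - + 2 * c) + (b - + 2 * d)
    regroup = solve-∀

  -- The coefficient of x^j in (1 - x)(1 - 2x) f′ = ((A + 1)(1 - 2x) - 2n(1 - x)) f for
  -- f = (1 - 2x)^n / (1 - x)^(A + 1), A = r + j + 1, after eliminating Q A (j - 1) n
  -- by Q-pascal.
  Q-three-term : ∀ n r j →
    (+ 1 + + j) * Q (suc (r ℕ.+ j)) (suc j) n + + r * Q (suc (r ℕ.+ j)) j n
      + + 2 * (+ n - + r - + 2 * + j - + 1) * Q (r ℕ.+ j) j n ≡ + 0
  Q-three-term n r zero = begin
    (+ 1 + + 0) * Q (suc (r ℕ.+ 0)) 1 n + + r * Q (suc (r ℕ.+ 0)) 0 n + + 2 * (+ n - + r - + 2 * + 0 - + 1) * Q (r ℕ.+ 0) 0 n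
      ≡⟨ cong₂ (λ u v → (+ 1 + + 0) * u + + r * v + + 2 * (+ n - + r - + 2 * + 0 - + 1) * Q (r ℕ.+ 0) 0 n)
               (trans (Q-one (suc (r ℕ.+ 0)) n) (cong (λ m → + suc (suc m) - + 2 * + n) (ℕₚ.+-identityʳ r)))
               (Q-zeroᵐ (suc (r ℕ.+ 0)) n) ⟩
    (+ 1 + + 0) * (+ 2 + + r - + 2 * + n) + + r * + 1 + + 2 * (+ n - + r - + 2 * + 0 - + 1) * Q (r ℕ.+ 0) 0 n
      ≡⟨ cong (λ v → (+ 1 + + 0) * (+ 2 + + r - + 2 * + n) + + r * + 1 + + 2 * (+ n - + r - + 2 * + 0 - + 1) * v)
              (Q-zeroᵐ (r ℕ.+ 0) n) ⟩
    (+ 1 + + 0) * (+ 2 + + r - + 2 * + n) + + r * + 1 + + 2 * (+ n - + r - + 2 * + 0 - + 1) * + 1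
      ≡⟨ vanish (+ r) (+ n) ⟩
    + 0 ∎
    where
    open ≡-Reasoning
    vanish : ∀ r n → (+ 1 + + 0) * (+ 2 + r - + 2 * n) + r * + 1 + + 2 * (n - r - + 2 * + 0 - + 1) * + 1 ≡ + 0
    vanish = solve-∀
  Q-three-term zero r (suc j) = begin
    (+ 1 + J) * Q A (suc k) 0 + + r * Q A k 0 + + 2 * (+ 0 - + r - + 2 * J - + 1) * Q B k 0
      ≡⟨ cong₂ (λ u v → (+ 1 + J) * u + + r * v + + 2 * (+ 0 - + r - + 2 * J - + 1) * Q B k 0) (Q-zeroⁿ A (suc k)) (Q-zeroⁿ A k) ⟩
    (+ 1 + J) * Z + + r * X + + 2 * (+ 0 - + r - + 2 * J - + 1) * Q B k 0
      ≡⟨ cong (λ v → (+ 1 + J) * Z + + r * X + + 2 * (+ 0 - + r - + 2 * J - + 1) * v) (Q-zeroⁿ B k) ⟩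
    (+ 1 + J) * Z + + r * X + + 2 * (+ 0 - + r - + 2 * J - + 1) * Y
      ≡⟨ vanish (+ r) J X Y Z absorbZ absorbX ⟩
    + 0 ∎
    where
    open ≡-Reasoning
    k = suc j
    J = + k
    B = r ℕ.+ k
    A = suc B
    X = + ((A ℕ.+ k) C A)
    Y = + ((B ℕ.+ k) C B)
    Z = + ((A ℕ.+ suc k) C A)
    absorbZ : (+ 1 + J) * Z ≡ (+ 1 + (+ 1 + (+ r + J + J))) * X
    absorbZ = begin
      + suc k * + ((A ℕ.+ suc k) C A)        ≡⟨ ℤ.pos-* (suc k) ((A ℕ.+ suc k) C A) ⟨
      + (suc k ℕ.* ((A ℕ.+ suc k) C A))      ≡⟨ cong (λ m → + (suc k ℕ.* (m C A))) (ℕₚ.+-suc A k) ⟩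
      + (suc k ℕ.* (suc (A ℕ.+ k) C A))      ≡⟨ cong +_ (C-absorb-top A k) ⟩
      + (suc (A ℕ.+ k) ℕ.* ((A ℕ.+ k) C A))  ≡⟨ ℤ.pos-* (suc (A ℕ.+ k)) ((A ℕ.+ k) C A) ⟩
      + suc (A ℕ.+ k) * X                    ∎
    absorbX : (+ 1 + (+ r + J)) * X ≡ (+ 1 + (+ r + J + J)) * Y
    absorbX = begin
      + suc B * X                            ≡⟨ ℤ.pos-* (suc B) ((A ℕ.+ k) C A) ⟨
      + (suc B ℕ.* ((A ℕ.+ k) C A))          ≡⟨ cong +_ (C-absorb (B ℕ.+ k) B) ⟩
      + (suc (B ℕ.+ k) ℕ.* ((B ℕ.+ k) C B))  ≡⟨ ℤ.pos-* (suc (B ℕ.+ k)) ((B ℕ.+ k) C B) ⟩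
      + suc (B ℕ.+ k) * Y                    ∎
    vanish : ∀ R J X Y Z → (+ 1 + J) * Z ≡ (+ 1 + (+ 1 + (R + J + J))) * X → (+ 1 + (R + J)) * X ≡ (+ 1 + (R + J + J)) * Y →
             (+ 1 + J) * Z + R * X + + 2 * (+ 0 - R - + 2 * J - + 1) * Y ≡ + 0
    vanish R J X Y Z eZ eX = begin
      (+ 1 + J) * Z + R * X + + 2 * (+ 0 - R - + 2 * J - + 1) * Y
        ≡⟨ expand R J X Y Z ⟩
      (+ 1 + J) * Z - (+ 1 + (+ 1 + (R + J + J))) * X + + 2 * ((+ 1 + (R + J)) * X - (+ 1 + (R + J + J)) * Y)
        ≡⟨ cong₂ (λ u v → u - (+ 1 + (+ 1 + (R + J + J))) * X + + 2 * (v - (+ 1 + (R + J + J)) * Y)) eZ eX ⟩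
      (+ 1 + (+ 1 + (R + J + J))) * X - (+ 1 + (+ 1 + (R + J + J))) * X + + 2 * ((+ 1 + (R + J + J)) * Y - (+ 1 + (R + J + J)) * Y)
        ≡⟨ cancel ((+ 1 + (+ 1 + (R + J + J))) * X) ((+ 1 + (R + J + J)) * Y) ⟩
      + 0 ∎
      where
      expand : ∀ R J X Y Z → (+ 1 + J) * Z + R * X + + 2 * (+ 0 - R - + 2 * J - + 1) * Y
                             ≡ (+ 1 + J) * Z - (+ 1 + (+ 1 + (R + J + J))) * X + + 2 * ((+ 1 + (R + J)) * X - (+ 1 + (R + J + J)) * Y)
      expand = solve-∀
      cancel : ∀ (a b : ℤ) → a - a + + 2 * (b - b) ≡ + 0
      cancel = solve-∀
  Q-three-term (suc n) r (suc j) = begin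
    (+ 1 + (+ 1 + J)) * Q A (suc (suc j)) (suc n) + + r * Q A (suc j) (suc n) + + 2 * (+ 1 + N - + r - + 2 * (+ 1 + J) - + 1) * Q B (suc j) (suc n)
      ≡⟨ cong₂ (λ u v → (+ 1 + (+ 1 + J)) * u + + r * v + + 2 * (+ 1 + N - + r - + 2 * (+ 1 + J) - + 1) * Q B (suc j) (suc n))
               (Q-suc-suc A (suc j) n) (Q-suc-suc A j n) ⟩
    (+ 1 + (+ 1 + J)) * (a₁ - + 2 * a₂) + + r * (a₂ - + 2 * a₃) + + 2 * (+ 1 + N - + r - + 2 * (+ 1 + J) - + 1) * Q B (suc j) (suc n)
      ≡⟨ cong (λ v → (+ 1 + (+ 1 + J)) * (a₁ - + 2 * a₂) + + r * (a₂ - + 2 * a₃) + + 2 * (+ 1 + N - + r - + 2 * (+ 1 + J) - + 1) * v)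
              (Q-suc-suc B j n) ⟩
    (+ 1 + (+ 1 + J)) * (a₁ - + 2 * a₂) + + r * (a₂ - + 2 * a₃) + + 2 * (+ 1 + N - + r - + 2 * (+ 1 + J) - + 1) * (b₁ - + 2 * b₂)
      ≡⟨ regroup (+ r) J N a₁ a₂ a₃ b₁ b₂ ⟩
    ((+ 1 + (+ 1 + J)) * a₁ + + r * a₂ + + 2 * (N - + r - + 2 * (+ 1 + J) - + 1) * b₁)
      - + 2 * ((+ 1 + J) * a₂ + (+ 1 + + r) * a₃ + + 2 * (N - (+ 1 + + r) - + 2 * J - + 1) * b₂)
      + + 2 * (b₁ + a₃ - a₂)
      ≡⟨ cong₂ (λ u v → u - + 2 * v + + 2 * (b₁ + a₃ - a₂)) (Q-three-term n r (suc j)) shifted ⟩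
    + 0 - + 2 * + 0 + + 2 * (b₁ + a₃ - a₂)
      ≡⟨ cong (λ z → + 0 - + 2 * + 0 + + 2 * (z - a₂)) (Q-pascal n B j) ⟨
    + 0 - + 2 * + 0 + + 2 * (a₂ - a₂)
      ≡⟨ cancel a₂ ⟩
    + 0 ∎
    where
    open ≡-Reasoning
    J = + j
    N = + n
    B = r ℕ.+ suc j
    A = suc B
    a₁ = Q A (suc (suc j)) n
    a₂ = Q A (suc j) n
    a₃ = Q A j n
    b₁ = Q B (suc j) n
    b₂ = Q B j n
    shifted : (+ 1 + J) * a₂ + (+ 1 + + r) * a₃ + + 2 * (N - (+ 1 + + r) - + 2 * J - + 1) * b₂ ≡ + 0
    shifted = subst (λ D → (+ 1 + J) * Q (suc D) (suc j) n + (+ 1 + + r) * Q (suc D) j n + + 2 * (N - (+ 1 + + r) - + 2 * J - + 1) * Q D j n ≡ + 0)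
                    (sym (ℕₚ.+-suc r j)) (Q-three-term n (suc r) j)
    regroup : ∀ R J N a₁ a₂ a₃ b₁ b₂ →
      (+ 1 + (+ 1 + J)) * (a₁ - + 2 * a₂) + R * (a₂ - + 2 * a₃) + + 2 * (+ 1 + N - R - + 2 * (+ 1 + J) - + 1) * (b₁ - + 2 * b₂)
        ≡ ((+ 1 + (+ 1 + J)) * a₁ + R * a₂ + + 2 * (N - R - + 2 * (+ 1 + J) - + 1) * b₁)
          - + 2 * ((+ 1 + J) * a₂ + (+ 1 + R) * a₃ + + 2 * (N - (+ 1 + R) - + 2 * J - + 1) * b₂)
          + + 2 * (b₁ + a₃ - a₂)
    regroup = solve-∀
    cancel : ∀ a → + 0 - + 2 * + 0 + + 2 * (a - a) ≡ + 0
    cancel = solve-∀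

  Q-rec : ∀ r j n →
    + r * Q (suc (r ℕ.+ j)) (suc j) (suc n)
      ≡ (+ r + + 2 * + j + + 2) * Q (suc (r ℕ.+ j)) (suc j) n + + 4 * (+ 1 + + n - (+ r + + 2 * + j + + 2)) * Q (r ℕ.+ j) j n
  Q-rec r j n = begin
    + r * Q A (suc j) (suc n)                         ≡⟨ cong (+ r *_) (Q-suc-suc A j n) ⟩
    + r * (Q A (suc j) n - + 2 * Q A j n)             ≡⟨ regroup (+ r) (+ j) (+ n) (Q A (suc j) n) (Q A j n) (Q B j n) ⟩
    K * Q A (suc j) n + + 4 * (+ 1 + + n - K) * Q B j n
      - + 2 * ((+ 1 + + j) * Q A (suc j) n + + r * Q A j n + + 2 * (+ n - + r - + 2 * + j - + 1) * Q B j n)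
                                                       ≡⟨ cong (λ z → K * Q A (suc j) n + + 4 * (+ 1 + + n - K) * Q B j n - + 2 * z) (Q-three-term n r j) ⟩
    K * Q A (suc j) n + + 4 * (+ 1 + + n - K) * Q B j n - + 2 * + 0
                                                       ≡⟨ drop (K * Q A (suc j) n + + 4 * (+ 1 + + n - K) * Q B j n) ⟩
    K * Q A (suc j) n + + 4 * (+ 1 + + n - K) * Q B j n ∎
    where
    open ≡-Reasoning
    B = r ℕ.+ j
    A = suc B
    K = + r + + 2 * + j + + 2
    regroup : ∀ R J N a₁ a₂ b₁ → R * (a₁ - + 2 * a₂)
      ≡ (R + + 2 * J + + 2) * a₁ + + 4 * (+ 1 + N - (R + + 2 * J + + 2)) * b₁
        - + 2 * ((+ 1 + J) * a₁ + R * a₂ + + 2 * (N - R - + 2 * J - + 1) * b₁)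
    regroup = solve-∀
    drop : ∀ x → x - + 2 * + 0 ≡ x
    drop = solve-∀

  -- T J e n is the right-hand side of the formula for k = e + 2J, as a sum over r = e + 2i.

  t : ℕ → ℕ → ℕ → ℕ → ℤ
  t J e n i = Q (e ℕ.+ i ℕ.+ J) (J ∸ i) n * + ((e ℕ.+ 2 ℕ.* i) ^ n)

  T : ℕ → ℕ → ℕ → ℤ
  T J e n = ∑ (suc J) (t J e n)

  t-rec : ∀ e i d n → let k = e ℕ.+ 2 ℕ.* suc (i ℕ.+ d) in
    t (suc (i ℕ.+ d)) e (suc n) i ≡ + k * t (suc (i ℕ.+ d)) e n i + + 4 * (+ 1 + + n - + k) * t (i ℕ.+ d) e n i
  t-rec e i d n = begin
    Q (e ℕ.+ i ℕ.+ suc (i ℕ.+ d)) (suc (i ℕ.+ d) ∸ i) (suc n) * + (r ^ suc n)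
      ≡⟨ cong₂ (λ A m → Q A m (suc n) * + (r ^ suc n)) index₁ index₂ ⟩
    Q (suc (r ℕ.+ d)) (suc d) (suc n) * + (r ℕ.* r ^ n)
      ≡⟨ cong (Q (suc (r ℕ.+ d)) (suc d) (suc n) *_) (ℤ.pos-* r (r ^ n)) ⟩
    Q (suc (r ℕ.+ d)) (suc d) (suc n) * (+ r * + (r ^ n))
      ≡⟨ x*[y*z]≡y*x*z (Q (suc (r ℕ.+ d)) (suc d) (suc n)) (+ r) (+ (r ^ n)) ⟩
    + r * Q (suc (r ℕ.+ d)) (suc d) (suc n) * + (r ^ n)
      ≡⟨ cong (_* + (r ^ n)) (Q-rec r d n) ⟩
    (K * Q (suc (r ℕ.+ d)) (suc d) n + + 4 * (+ 1 + + n - K) * Q (r ℕ.+ d) d n) * + (r ^ n)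
      ≡⟨ cong (λ z → (z * Q (suc (r ℕ.+ d)) (suc d) n + + 4 * (+ 1 + + n - z) * Q (r ℕ.+ d) d n) * + (r ^ n)) K≡k ⟩
    (+ k * Q (suc (r ℕ.+ d)) (suc d) n + + 4 * (+ 1 + + n - + k) * Q (r ℕ.+ d) d n) * + (r ^ n)
      ≡⟨ distribute (+ k) (Q (suc (r ℕ.+ d)) (suc d) n) (+ 4 * (+ 1 + + n - + k)) (Q (r ℕ.+ d) d n) (+ (r ^ n)) ⟩
    + k * (Q (suc (r ℕ.+ d)) (suc d) n * + (r ^ n)) + + 4 * (+ 1 + + n - + k) * (Q (r ℕ.+ d) d n * + (r ^ n))
      ≡⟨ cong₂ (λ u v → + k * u + + 4 * (+ 1 + + n - + k) * v)
               (cong₂ (λ A m → Q A m n * + (r ^ n)) index₁ index₂) (cong₂ (λ A m → Q A m n * + (r ^ n)) index₃ index₄) ⟨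
    + k * t (suc (i ℕ.+ d)) e n i + + 4 * (+ 1 + + n - + k) * t (i ℕ.+ d) e n i
      ∎
    where
    open ≡-Reasoning
    r = e ℕ.+ 2 ℕ.* i
    k = e ℕ.+ 2 ℕ.* suc (i ℕ.+ d)
    K = + r + + 2 * + d + + 2
    index₁ : e ℕ.+ i ℕ.+ suc (i ℕ.+ d) ≡ suc (r ℕ.+ d)
    index₁ = solve₁ e i d
      where
      solve₁ : ∀ e i d → e ℕ.+ i ℕ.+ suc (i ℕ.+ d) ≡ suc (e ℕ.+ 2 ℕ.* i ℕ.+ d)
      solve₁ = ℕ-Solver.solve-∀
    index₂ : suc (i ℕ.+ d) ∸ i ≡ suc d
    index₂ = trans (cong (_∸ i) (sym (ℕₚ.+-suc i d))) (ℕₚ.m+n∸m≡n i (suc d))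
    index₃ : e ℕ.+ i ℕ.+ (i ℕ.+ d) ≡ r ℕ.+ d
    index₃ = solve₃ e i d
      where
      solve₃ : ∀ e i d → e ℕ.+ i ℕ.+ (i ℕ.+ d) ≡ e ℕ.+ 2 ℕ.* i ℕ.+ d
      solve₃ = ℕ-Solver.solve-∀
    index₄ : (i ℕ.+ d) ∸ i ≡ d
    index₄ = ℕₚ.m+n∸m≡n i d
    K≡k : K ≡ + k
    K≡k = begin
      + r + + 2 * + d + + 2     ≡⟨ cong (λ z → + r + z + + 2) (ℤ.pos-* 2 d) ⟨
      + r + + (2 ℕ.* d) + + 2   ≡⟨ cong (_+ + 2) (ℤ.pos-+ r (2 ℕ.* d)) ⟨
      + (r ℕ.+ 2 ℕ.* d) + + 2   ≡⟨ ℤ.pos-+ (r ℕ.+ 2 ℕ.* d) 2 ⟨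
      + (r ℕ.+ 2 ℕ.* d ℕ.+ 2)   ≡⟨ cong +_ (solveK e i d) ⟩
      + k                       ∎
      where
      solveK : ∀ e i d → e ℕ.+ 2 ℕ.* i ℕ.+ 2 ℕ.* d ℕ.+ 2 ≡ e ℕ.+ 2 ℕ.* suc (i ℕ.+ d)
      solveK = ℕ-Solver.solve-∀
    x*[y*z]≡y*x*z : ∀ x y z → x * (y * z) ≡ y * x * z
    x*[y*z]≡y*x*z = solve-∀
    distribute : ∀ a x b y z → (a * x + b * y) * z ≡ a * (x * z) + b * (y * z)
    distribute = solve-∀

  T-rec : ∀ J e n → let k = e ℕ.+ 2 ℕ.* suc J in
    T (suc J) e (suc n) ≡ + k * T (suc J) e n + + 4 * (+ 1 + + n - + k) * T J e n
  T-rec J e n = begin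
    ∑ (suc (suc J)) (t (suc J) e (suc n))
      ≡⟨ ∑-last (suc J) (t (suc J) e (suc n)) ⟩
    ∑ (suc J) (t (suc J) e (suc n)) + t (suc J) e (suc n) (suc J)
      ≡⟨ cong₂ _+_ (∑-cong (suc J) below) top ⟩
    ∑[ i < suc J ] (K * t (suc J) e n i + L * t J e n i) + K * t (suc J) e n (suc J)
      ≡⟨ cong (_+ K * t (suc J) e n (suc J)) (trans (∑-+ (suc J) (λ i → K * t (suc J) e n i) (λ i → L * t J e n i))
                                                     (cong₂ _+_ (∑-*ˡ (suc J) K (t (suc J) e n)) (∑-*ˡ (suc J) L (t J e n)))) ⟩
    K * ∑ (suc J) (t (suc J) e n) + L * T J e n + K * t (suc J) e n (suc J)
      ≡⟨ regroup K (∑ (suc J) (t (suc J) e n)) (L * T J e n) (t (suc J) e n (suc J)) ⟩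
    K * (∑ (suc J) (t (suc J) e n) + t (suc J) e n (suc J)) + L * T J e n
      ≡⟨ cong (λ z → K * z + L * T J e n) (∑-last (suc J) (t (suc J) e n)) ⟨
    K * T (suc J) e n + L * T J e n
      ∎
    where
    open ≡-Reasoning
    k = e ℕ.+ 2 ℕ.* suc J
    K = + k
    L = + 4 * (+ 1 + + n - K)
    regroup : ∀ a x y z → a * x + y + a * z ≡ a * (x + z) + y
    regroup = solve-∀
    below : ∀ i → i < suc J → t (suc J) e (suc n) i ≡ K * t (suc J) e n i + L * t J e n i
    below i (s≤s i≤J) with ℕₚ.m≤n⇒∃[o]m+o≡n i≤J
    ... | d , refl = t-rec e i d n
    Q₀ : ∀ m → Q (e ℕ.+ suc J ℕ.+ suc J) (suc J ∸ suc J) m ≡ + 1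
    Q₀ m = trans (cong (λ z → Q (e ℕ.+ suc J ℕ.+ suc J) z m) (ℕₚ.n∸n≡0 J)) (Q-zeroᵐ (e ℕ.+ suc J ℕ.+ suc J) m)
    top : t (suc J) e (suc n) (suc J) ≡ K * t (suc J) e n (suc J)
    top = begin
      Q (e ℕ.+ suc J ℕ.+ suc J) (suc J ∸ suc J) (suc n) * + (k ^ suc n)  ≡⟨ cong (_* + (k ^ suc n)) (Q₀ (suc n)) ⟩
      + 1 * + (k ^ suc n)                                                 ≡⟨ ℤ.*-identityˡ _ ⟩
      + (k ℕ.* k ^ n)                                                     ≡⟨ ℤ.pos-* k (k ^ n) ⟩
      K * + (k ^ n)                                                       ≡⟨ cong (K *_) (ℤ.*-identityˡ _) ⟨
      K * (+ 1 * + (k ^ n))                                               ≡⟨ cong (λ z → K * (z * + (k ^ n))) (Q₀ n) ⟨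
      K * (Q (e ℕ.+ suc J ℕ.+ suc J) (suc J ∸ suc J) n * + (k ^ n))       ∎

  U : ℕ → ℕ → ℤ
  U e J = ∑[ i < suc J ] (+ ((e ℕ.+ 2 ℕ.* J) C (e ℕ.+ J ℕ.+ i)))

  T-zeroⁿ : ∀ J e → T J e 0 ≡ U e J
  T-zeroⁿ J e = ∑-cong (suc J) entry
    where
    entry : ∀ i → i < suc J → t J e 0 i ≡ + ((e ℕ.+ 2 ℕ.* J) C (e ℕ.+ J ℕ.+ i))
    entry i (s≤s i≤J) with ℕₚ.m≤n⇒∃[o]m+o≡n i≤J
    ... | d , refl = trans (ℤ.*-identityʳ _) (trans (Q-zeroⁿ (e ℕ.+ i ℕ.+ (i ℕ.+ d)) ((i ℕ.+ d) ∸ i))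
                       (cong₂ (λ m k → + (m C k)) (trans (cong (e ℕ.+ i ℕ.+ (i ℕ.+ d) ℕ.+_) (ℕₚ.m+n∸m≡n i d)) (row e i d)) (column e i d)))
      where
      row : ∀ e i d → e ℕ.+ i ℕ.+ (i ℕ.+ d) ℕ.+ d ≡ e ℕ.+ 2 ℕ.* (i ℕ.+ d)
      row = ℕ-Solver.solve-∀
      column : ∀ e i d → e ℕ.+ i ℕ.+ (i ℕ.+ d) ≡ e ℕ.+ (i ℕ.+ d) ℕ.+ i
      column = ℕ-Solver.solve-∀

  C-beyond-half : ∀ e J → (e ℕ.+ 2 ℕ.* J) C (e ℕ.+ J ℕ.+ suc J) ≡ 0
  C-beyond-half e J = k>n⇒nCk≡0 (ℕₚ.≤-reflexive (trans (cong suc (beyond e J)) (sym (ℕₚ.+-suc (e ℕ.+ J) J))))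
    where
    beyond : ∀ e J → e ℕ.+ 2 ℕ.* J ≡ e ℕ.+ J ℕ.+ J
    beyond = ℕ-Solver.solve-∀

  U-odd+middle : ∀ J → U 1 J + + ((2 ℕ.* J) C J) ≡ + 2 * U 0 J
  U-odd+middle J = begin
    U 1 J + + ((2 ℕ.* J) C J)
      ≡⟨ cong₂ _+_ (trans (∑-cong (suc J) (λ i _ → split i)) (∑-+ (suc J) f (f ∘ suc)))
                   (cong (λ m → + ((2 ℕ.* J) C m)) (sym (ℕₚ.+-identityʳ J))) ⟩
    (∑ (suc J) f + ∑ (suc J) (f ∘ suc)) + f 0     ≡⟨ regroup (∑ (suc J) f) (∑ (suc J) (f ∘ suc)) (f 0) ⟩
    ∑ (suc J) f + (f 0 + ∑ (suc J) (f ∘ suc))     ≡⟨ cong (_+_ (∑ (suc J) f)) (∑-last (suc J) f) ⟩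
    ∑ (suc J) f + (∑ (suc J) f + f (suc J))       ≡⟨ cong (λ z → ∑ (suc J) f + (∑ (suc J) f + + z)) (C-beyond-half 0 J) ⟩
    ∑ (suc J) f + (∑ (suc J) f + + 0)             ≡⟨ double (∑ (suc J) f) ⟩
    + 2 * U 0 J                                   ∎
    where
    open ≡-Reasoning
    f : ℕ → ℤ
    f i = + ((2 ℕ.* J) C (J ℕ.+ i))
    split : ∀ i → + (suc (2 ℕ.* J) C suc (J ℕ.+ i)) ≡ f i + f (suc i)
    split i = trans (cong +_ (pascal (2 ℕ.* J) (J ℕ.+ i)))
                    (trans (ℤ.pos-+ ((2 ℕ.* J) C (J ℕ.+ i)) _) (cong (λ m → f i + + ((2 ℕ.* J) C m)) (sym (ℕₚ.+-suc J i))))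
    regroup : ∀ a b c → a + b + c ≡ a + (c + b)
    regroup = solve-∀
    double : ∀ a → a + (a + + 0) ≡ + 2 * a
    double = solve-∀

  U-even-suc : ∀ J → U 0 (suc J) ≡ + (suc (2 ℕ.* J) C J) + + 2 * U 1 J
  U-even-suc J = begin
    U 0 (suc J)
      ≡⟨ ∑-cong (suc (suc J)) (λ i _ → split i) ⟩
    ∑[ i < suc (suc J) ] (g i + g (suc i))
      ≡⟨ ∑-+ (suc (suc J)) g (g ∘ suc) ⟩
    (g 0 + ∑ (suc J) (g ∘ suc)) + ∑ (suc (suc J)) (g ∘ suc)
      ≡⟨ cong₂ (λ u v → (g 0 + u) + v) tail (∑-last (suc J) (g ∘ suc)) ⟩
    (g 0 + U 1 J) + (∑ (suc J) (g ∘ suc) + g (suc (suc J)))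
      ≡⟨ cong (λ u → (g 0 + U 1 J) + (u + g (suc (suc J)))) tail ⟩
    (g 0 + U 1 J) + (U 1 J + g (suc (suc J)))
      ≡⟨ cong₂ (λ u v → (+ u + U 1 J) + (U 1 J + + v)) (cong (suc (2 ℕ.* J) C_) (ℕₚ.+-identityʳ J))
               (trans (cong (suc (2 ℕ.* J) C_) (ℕₚ.+-suc J (suc J))) (C-beyond-half 1 J)) ⟩
    (+ (suc (2 ℕ.* J) C J) + U 1 J) + (U 1 J + + 0)
      ≡⟨ regroup (+ (suc (2 ℕ.* J) C J)) (U 1 J) ⟩
    + (suc (2 ℕ.* J) C J) + + 2 * U 1 J
      ∎
    where
    open ≡-Reasoning
    g : ℕ → ℤ
    g i = + (suc (2 ℕ.* J) C (J ℕ.+ i))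
    row : 2 ℕ.* suc J ≡ suc (suc (2 ℕ.* J))
    row = ℕₚ.*-suc 2 J
    split : ∀ i → + ((2 ℕ.* suc J) C (suc J ℕ.+ i)) ≡ g i + g (suc i)
    split i = trans (cong (λ m → + (m C suc (J ℕ.+ i))) row)
                    (trans (cong +_ (pascal (suc (2 ℕ.* J)) (J ℕ.+ i)))
                    (trans (ℤ.pos-+ (suc (2 ℕ.* J) C (J ℕ.+ i)) _) (cong (λ m → g i + + (suc (2 ℕ.* J) C m)) (sym (ℕₚ.+-suc J i)))))
    tail : ∑ (suc J) (g ∘ suc) ≡ U 1 J
    tail = ∑-cong (suc J) (λ i _ → cong (λ m → + (suc (2 ℕ.* J) C m)) (ℕₚ.+-suc J i))
    regroup : ∀ a u → (a + u) + (u + + 0) ≡ a + + 2 * u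
    regroup = solve-∀

  C-odd-row-middle : ∀ J → suc (2 ℕ.* J) C suc J ≡ suc (2 ℕ.* J) C J
  C-odd-row-middle J = subst (λ m → m C suc J ≡ m C J) row (C-sym (suc J) J)
    where
    row : suc J ℕ.+ J ≡ suc (2 ℕ.* J)
    row = cong suc (cong (J ℕ.+_) (sym (ℕₚ.+-identityʳ J)))

  middle-double : ∀ J → (2 ℕ.* suc J) C suc J ≡ suc (2 ℕ.* J) C J ℕ.+ suc (2 ℕ.* J) C J
  middle-double J = begin
    (2 ℕ.* suc J) C suc J                          ≡⟨ cong (_C suc J) (ℕₚ.*-suc 2 J) ⟩
    suc (suc (2 ℕ.* J)) C suc J                    ≡⟨ pascal (suc (2 ℕ.* J)) J ⟩
    suc (2 ℕ.* J) C J ℕ.+ suc (2 ℕ.* J) C suc J    ≡⟨ cong (suc (2 ℕ.* J) C J ℕ.+_) (C-odd-row-middle J) ⟩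
    suc (2 ℕ.* J) C J ℕ.+ suc (2 ℕ.* J) C J        ∎
    where open ≡-Reasoning

  middle-absorb : ∀ J → 2 ℕ.* suc J ℕ.* ((2 ℕ.* suc J) C suc J) ≡ 4 ℕ.* (suc (2 ℕ.* J) ℕ.* ((2 ℕ.* J) C J))
  middle-absorb J = begin
    2 ℕ.* suc J ℕ.* ((2 ℕ.* suc J) C suc J)     ≡⟨ cong (2 ℕ.* suc J ℕ.*_) (middle-double J) ⟩
    2 ℕ.* suc J ℕ.* (c ℕ.+ c)                    ≡⟨ regroup (suc J) c ⟩
    4 ℕ.* (suc J ℕ.* c)                          ≡⟨ cong (λ m → 4 ℕ.* (suc J ℕ.* m)) (C-odd-row-middle J) ⟨
    4 ℕ.* (suc J ℕ.* (suc (2 ℕ.* J) C suc J))    ≡⟨ cong (4 ℕ.*_) (C-absorb (2 ℕ.* J) J) ⟩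
    4 ℕ.* (suc (2 ℕ.* J) ℕ.* ((2 ℕ.* J) C J))    ∎
    where
    open ≡-Reasoning
    c = suc (2 ℕ.* J) C J
    regroup : ∀ a x → 2 ℕ.* a ℕ.* (x ℕ.+ x) ≡ 4 ℕ.* (a ℕ.* x)
    regroup = ℕ-Solver.solve-∀

  U-values : ∀ J → U 1 J ≡ + (4 ^ J) × + 2 * U 0 J ≡ + (4 ^ J) + + ((2 ℕ.* J) C J)
  U-values zero    = refl , refl
  U-values (suc J) = odd , even
    where
    X = + ((2 ℕ.* suc J) C suc J)
    c = suc (2 ℕ.* J) C J
    even : + 2 * U 0 (suc J) ≡ + (4 ^ suc J) + X
    even = begin
      + 2 * U 0 (suc J)                           ≡⟨ cong (+ 2 *_) (U-even-suc J) ⟩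
      + 2 * (+ c + + 2 * U 1 J)                   ≡⟨ cong (λ u → + 2 * (+ c + + 2 * u)) (proj₁ (U-values J)) ⟩
      + 2 * (+ c + + 2 * + (4 ^ J))               ≡⟨ regroup (+ c) (+ (4 ^ J)) ⟩
      + 4 * + (4 ^ J) + (+ c + + c)               ≡⟨ cong₂ _+_ (ℤ.pos-* 4 (4 ^ J)) (ℤ.pos-+ c c) ⟨
      + (4 ^ suc J) + + (c ℕ.+ c)                 ≡⟨ cong (λ m → + (4 ^ suc J) + + m) (middle-double J) ⟨
      + (4 ^ suc J) + X                           ∎
      where
      open ≡-Reasoning
      regroup : ∀ c p → + 2 * (c + + 2 * p) ≡ + 4 * p + (c + c)
      regroup = solve-∀
    odd : U 1 (suc J) ≡ + (4 ^ suc J)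
    odd = +-cancelʳ X (U 1 (suc J)) (+ (4 ^ suc J)) (trans (U-odd+middle (suc J)) even)

  T-one-odd : ∀ J → T J 1 1 ≡ + (4 ^ J)
  T-one-odd zero    = refl
  T-one-odd (suc J) = begin
    T (suc J) 1 1                                          ≡⟨ T-rec J 1 0 ⟩
    K * T (suc J) 1 0 + + 4 * (+ 1 + + 0 - K) * T J 1 0    ≡⟨ cong₂ (λ u v → K * u + + 4 * (+ 1 + + 0 - K) * v)
                                                                     (trans (T-zeroⁿ (suc J) 1) (proj₁ (U-values (suc J))))
                                                                     (trans (T-zeroⁿ J 1) (proj₁ (U-values J))) ⟩
    K * + (4 ^ suc J) + + 4 * (+ 1 + + 0 - K) * + (4 ^ J)  ≡⟨ cong (λ u → K * u + + 4 * (+ 1 + + 0 - K) * + (4 ^ J)) (ℤ.pos-* 4 (4 ^ J)) ⟩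
    K * (+ 4 * + (4 ^ J)) + + 4 * (+ 1 + + 0 - K) * + (4 ^ J) ≡⟨ collapse K (+ (4 ^ J)) ⟩
    + 4 * + (4 ^ J)                                         ≡⟨ ℤ.pos-* 4 (4 ^ J) ⟨
    + (4 ^ suc J)                                           ∎
    where
    open ≡-Reasoning
    K = + (1 ℕ.+ 2 ℕ.* suc J)
    collapse : ∀ K F → K * (+ 4 * F) + + 4 * (+ 1 + + 0 - K) * F ≡ + 4 * F
    collapse = solve-∀

  T-one-even : ∀ J → T (suc J) 0 1 ≡ + (2 ℕ.* 4 ^ J)
  T-one-even J = ℤ.*-cancelˡ-≡ (+ 2) _ _ (begin
    + 2 * T (suc J) 0 1                                              ≡⟨ cong (+ 2 *_) (T-rec J 0 0) ⟩
    + 2 * (K * T (suc J) 0 0 + + 4 * (+ 1 + + 0 - K) * T J 0 0)      ≡⟨ cong₂ (λ u v → + 2 * (K * u + + 4 * (+ 1 + + 0 - K) * v))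
                                                                               (T-zeroⁿ (suc J) 0) (T-zeroⁿ J 0) ⟩
    + 2 * (K * U 0 (suc J) + + 4 * (+ 1 + + 0 - K) * U 0 J)          ≡⟨ distribute K (U 0 (suc J)) (U 0 J) ⟩
    K * (+ 2 * U 0 (suc J)) + + 4 * (+ 1 + + 0 - K) * (+ 2 * U 0 J)  ≡⟨ cong₂ (λ u v → K * u + + 4 * (+ 1 + + 0 - K) * v)
                                                                               (proj₂ (U-values (suc J))) (proj₂ (U-values J)) ⟩
    K * (+ (4 ^ suc J) + X₂) + + 4 * (+ 1 + + 0 - K) * (F + X₀)      ≡⟨ cong (λ u → K * (u + X₂) + + 4 * (+ 1 + + 0 - K) * (F + X₀))
                                                                             (ℤ.pos-* 4 (4 ^ J)) ⟩
    K * (+ 4 * F + X₂) + + 4 * (+ 1 + + 0 - K) * (F + X₀)            ≡⟨ regroup K F X₂ X₀ ⟩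
    + 4 * F + (K * X₂ - + 4 * (K - + 1) * X₀)                        ≡⟨ cong (λ z → + 4 * F + (z - + 4 * (K - + 1) * X₀)) middle ⟩
    + 4 * F + (+ 4 * (K - + 1) * X₀ - + 4 * (K - + 1) * X₀)          ≡⟨ cancel F (+ 4 * (K - + 1) * X₀) ⟩
    + 2 * (+ 2 * F)                                                  ≡⟨ cong (+ 2 *_) (ℤ.pos-* 2 (4 ^ J)) ⟨
    + 2 * + (2 ℕ.* 4 ^ J)                                            ∎)
    where
    open ≡-Reasoning
    K = + (2 ℕ.* suc J)
    F = + (4 ^ J)
    X₂ = + ((2 ℕ.* suc J) C suc J)
    X₀ = + ((2 ℕ.* J) C J)
    middle : K * X₂ ≡ + 4 * (K - + 1) * X₀
    middle = begin
      K * X₂                                              ≡⟨ ℤ.pos-* (2 ℕ.* suc J) ((2 ℕ.* suc J) C suc J) ⟨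
      + (2 ℕ.* suc J ℕ.* ((2 ℕ.* suc J) C suc J))         ≡⟨ cong +_ (middle-absorb J) ⟩
      + (4 ℕ.* (suc (2 ℕ.* J) ℕ.* ((2 ℕ.* J) C J)))       ≡⟨ trans (ℤ.pos-* 4 (suc (2 ℕ.* J) ℕ.* ((2 ℕ.* J) C J)))
                                                                   (cong (+ 4 *_) (ℤ.pos-* (suc (2 ℕ.* J)) ((2 ℕ.* J) C J))) ⟩
      + 4 * (+ suc (2 ℕ.* J) * X₀)                        ≡⟨ cong (λ z → + 4 * (z * X₀)) odd≡K-1 ⟩
      + 4 * ((K - + 1) * X₀)                              ≡⟨ ℤ.*-assoc (+ 4) (K - + 1) X₀ ⟨
      + 4 * (K - + 1) * X₀                                ∎
      where
      add-sub : ∀ x → + 1 + x - + 1 ≡ x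
      add-sub = solve-∀
      odd≡K-1 : + suc (2 ℕ.* J) ≡ K - + 1
      odd≡K-1 = trans (sym (add-sub (+ suc (2 ℕ.* J)))) (cong (λ m → + m - + 1) (sym (ℕₚ.*-suc 2 J)))
    distribute : ∀ K a b → + 2 * (K * a + + 4 * (+ 1 + + 0 - K) * b) ≡ K * (+ 2 * a) + + 4 * (+ 1 + + 0 - K) * (+ 2 * b)
    distribute = solve-∀
    regroup : ∀ K F X₂ X₀ → K * (+ 4 * F + X₂) + + 4 * (+ 1 + + 0 - K) * (F + X₀) ≡ + 4 * F + (K * X₂ - + 4 * (K - + 1) * X₀)
    regroup = solve-∀
    cancel : ∀ F Y → + 4 * F + (Y - Y) ≡ + 2 * (+ 2 * F)
    cancel = solve-∀

  sumℤ-++ : ∀ xs ys → sumℤ (xs ++ ys) ≡ sumℤ xs + sumℤ ys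
  sumℤ-++ []       ys = sym (ℤ.+-identityˡ _)
  sumℤ-++ (x ∷ xs) ys = trans (cong (_+_ x) (sumℤ-++ xs ys)) (sym (ℤ.+-assoc x _ _))

  sumℤ-concatMap : ∀ {A : Set} (f : A → List ℤ) xs → sumℤ (concatMap f xs) ≡ sumℤ (map (sumℤ ∘ f) xs)
  sumℤ-concatMap f []       = refl
  sumℤ-concatMap f (x ∷ xs) = trans (sumℤ-++ (f x) (concatMap f xs)) (cong (_+_ (sumℤ (f x))) (sumℤ-concatMap f xs))

  sumℤ-applyUpTo : ∀ N (g : ℕ → ℤ) (f : ℕ → ℕ) → sumℤ (map g (applyUpTo f N)) ≡ ∑[ i < N ] g (f i)
  sumℤ-applyUpTo zero    g f = refl
  sumℤ-applyUpTo (suc N) g f = cong (_+_ (g (f 0))) (sumℤ-applyUpTo N g (f ∘ suc))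

  rhsSum≡∑∑ : ∀ k n → rhsSum k n ≡ ∑[ r < suc k ] ∑[ s < suc k ] term k n r s
  rhsSum≡∑∑ k n = begin
    sumℤ (concatMap (λ r → map (term k n r) (upTo (suc k))) (upTo (suc k)))
      ≡⟨ sumℤ-concatMap (λ r → map (term k n r) (upTo (suc k))) (upTo (suc k)) ⟩
    sumℤ (map (λ r → sumℤ (map (term k n r) (upTo (suc k)))) (upTo (suc k)))
      ≡⟨ sumℤ-applyUpTo (suc k) (λ r → sumℤ (map (term k n r) (upTo (suc k)))) id ⟩
    ∑[ r < suc k ] sumℤ (map (term k n r) (upTo (suc k)))
      ≡⟨ ∑-cong (suc k) (λ r _ → sumℤ-applyUpTo (suc k) (term k n r) id) ⟩
    ∑[ r < suc k ] ∑[ s < suc k ] term k n r s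
      ∎
    where open ≡-Reasoning

  ∑-truncate : ∀ N M (X : ℕ → ℤ) → M ≤ N → ∑[ s < N ] (if s <ᵇ M then X s else + 0) ≡ ∑ M X
  ∑-truncate N       zero    X _         = ∑-zero N
  ∑-truncate (suc N) (suc M) X (s≤s M≤N) = cong (_+_ (X 0)) (∑-truncate N M (X ∘ suc) M≤N)

  ∑-even : ∀ J (h : ℕ → ℤ) → (∀ i → h (suc (2 ℕ.* i)) ≡ + 0) → ∑ (suc (2 ℕ.* J)) h ≡ ∑[ i < suc J ] h (2 ℕ.* i)
  ∑-even zero    h odd = refl
  ∑-even (suc J) h odd = begin
    ∑ (suc (2 ℕ.* suc J)) h                                     ≡⟨ cong (λ m → ∑ (suc m) h) (ℕₚ.*-suc 2 J) ⟩
    ∑ (suc (suc (suc (2 ℕ.* J)))) h                             ≡⟨ ∑-last (suc (suc (2 ℕ.* J))) h ⟩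
    ∑ (suc (suc (2 ℕ.* J))) h + h (suc (suc (2 ℕ.* J)))         ≡⟨ cong (_+ h (suc (suc (2 ℕ.* J)))) (∑-last (suc (2 ℕ.* J)) h) ⟩
    ∑ (suc (2 ℕ.* J)) h + h (suc (2 ℕ.* J)) + h (suc (suc (2 ℕ.* J)))
      ≡⟨ cong₂ (λ u v → u + v + h (suc (suc (2 ℕ.* J)))) (∑-even J h odd) (odd J) ⟩
    ∑[ i < suc J ] h (2 ℕ.* i) + + 0 + h (suc (suc (2 ℕ.* J)))
      ≡⟨ cong₂ (λ u m → u + h m) (ℤ.+-identityʳ (∑[ i < suc J ] h (2 ℕ.* i))) (sym (ℕₚ.*-suc 2 J)) ⟩
    ∑[ i < suc J ] h (2 ℕ.* i) + h (2 ℕ.* suc J)                ≡⟨ ∑-last (suc J) (λ i → h (2 ℕ.* i)) ⟨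
    ∑[ i < suc (suc J) ] h (2 ℕ.* i)                            ∎
    where open ≡-Reasoning

  [m+2i]%2≡m%2 : ∀ m i → (m ℕ.+ 2 ℕ.* i) % 2 ≡ m % 2
  [m+2i]%2≡m%2 m i = trans (cong (λ x → (m ℕ.+ x) % 2) (ℕₚ.*-comm 2 i)) ([m+kn]%n≡m%n m i 2)

  inner-vanish : ∀ k n r → (r % 2 ≡ᵇ k % 2) ≡ false → ∑[ s < suc k ] term k n r s ≡ + 0
  inner-vanish k n r parity = trans (∑-cong (suc k) zero-term) (∑-zero (suc k))
    where
    zero-term : ∀ s → s < suc k → term k n r s ≡ + 0
    zero-term s _ rewrite parity | ∧-zeroʳ (r ℕ.+ 2 ℕ.* s <ᵇ suc k) = refl

  <ᵇ-+ˡ : ∀ a x y → (a ℕ.+ x <ᵇ a ℕ.+ y) ≡ (x <ᵇ y)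
  <ᵇ-+ˡ zero    x y = refl
  <ᵇ-+ˡ (suc a) x y = <ᵇ-+ˡ a x y

  2*<ᵇ1+2* : ∀ s d → (2 ℕ.* s <ᵇ suc (2 ℕ.* d)) ≡ (s <ᵇ suc d)
  2*<ᵇ1+2* zero    d       = refl
  2*<ᵇ1+2* (suc s) zero    = cong (_<ᵇ 1) (ℕₚ.*-suc 2 s)
  2*<ᵇ1+2* (suc s) (suc d) = trans (cong₂ (λ a b → a <ᵇ suc b) (ℕₚ.*-suc 2 s) (ℕₚ.*-suc 2 d)) (2*<ᵇ1+2* s d)

  inner-match : ∀ e i d n → let k = e ℕ.+ 2 ℕ.* (i ℕ.+ d) in
    ∑[ s < suc k ] term k n (e ℕ.+ 2 ℕ.* i) s ≡ t (i ℕ.+ d) e n i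
  inner-match e i d n = begin
    ∑[ s < suc k ] term k n r s                     ≡⟨ ∑-cong (suc k) (λ s _ → cong (λ b → if b then X s else + 0) (condition s)) ⟩
    ∑[ s < suc k ] (if s <ᵇ suc d then X s else + 0) ≡⟨ ∑-truncate (suc k) (suc d) X (s≤s d≤k) ⟩
    ∑ (suc d) X                                     ≡⟨ ∑-cong (suc d) X≡ ⟩
    ∑[ s < suc d ] (q A d n s * + (r ^ n))          ≡⟨ ∑-*ʳ (suc d) (q A d n) (+ (r ^ n)) ⟩
    Q A d n * + (r ^ n)                             ≡⟨ cong (λ m → Q A m n * + (r ^ n)) (ℕₚ.m+n∸m≡n i d) ⟨
    t (i ℕ.+ d) e n i                               ∎
    where
    open ≡-Reasoning
    k = e ℕ.+ 2 ℕ.* (i ℕ.+ d)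
    r = e ℕ.+ 2 ℕ.* i
    A = e ℕ.+ i ℕ.+ (i ℕ.+ d)
    X : ℕ → ℤ
    X s = (- + 2) ^ℤ s * + (((k ∸ s) C ((k ℕ.+ r) / 2)) ℕ.* (n C s) ℕ.* (r ^ n))
    k≡r+2d : k ≡ r ℕ.+ 2 ℕ.* d
    k≡r+2d = solve₁ e i d
      where
      solve₁ : ∀ e i d → e ℕ.+ 2 ℕ.* (i ℕ.+ d) ≡ e ℕ.+ 2 ℕ.* i ℕ.+ 2 ℕ.* d
      solve₁ = ℕ-Solver.solve-∀
    d≤k : d ≤ k
    d≤k = ℕₚ.≤-trans (ℕₚ.m≤n*m d 2) (ℕₚ.≤-trans (ℕₚ.m≤n+m (2 ℕ.* d) r) (ℕₚ.≤-reflexive (sym k≡r+2d)))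
    same-parity : (r % 2 ≡ᵇ k % 2) ≡ true
    same-parity = trans (cong₂ _≡ᵇ_ ([m+2i]%2≡m%2 e i) ([m+2i]%2≡m%2 e (i ℕ.+ d))) (≡ᵇ-refl (e % 2))
    condition : ∀ s → ((r ℕ.+ 2 ℕ.* s <ᵇ suc k) ∧ (r % 2 ≡ᵇ k % 2)) ≡ (s <ᵇ suc d)
    condition s rewrite same-parity | ∧-identityʳ (r ℕ.+ 2 ℕ.* s <ᵇ suc k) =
      trans (cong (λ m → r ℕ.+ 2 ℕ.* s <ᵇ suc m) k≡r+2d)
            (trans (cong (r ℕ.+ 2 ℕ.* s <ᵇ_) (sym (ℕₚ.+-suc r (2 ℕ.* d)))) (trans (<ᵇ-+ˡ r (2 ℕ.* s) (suc (2 ℕ.* d))) (2*<ᵇ1+2* s d)))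
    half : (k ℕ.+ r) / 2 ≡ A
    half = trans (cong (_/ 2) (solve₂ e i d)) (m*n/n≡m A 2)
      where
      solve₂ : ∀ e i d → e ℕ.+ 2 ℕ.* (i ℕ.+ d) ℕ.+ (e ℕ.+ 2 ℕ.* i) ≡ (e ℕ.+ i ℕ.+ (i ℕ.+ d)) ℕ.* 2
      solve₂ = ℕ-Solver.solve-∀
    X≡ : ∀ s → s < suc d → X s ≡ q A d n s * + (r ^ n)
    X≡ s (s≤s s≤d) with ℕₚ.m≤n⇒∃[o]m+o≡n s≤d
    ... | u , refl = begin
      (- + 2) ^ℤ s * + (((k ∸ s) C ((k ℕ.+ r) / 2)) ℕ.* (n C s) ℕ.* (r ^ n))
        ≡⟨ cong₂ (λ a b → (- + 2) ^ℤ s * + ((a C b) ℕ.* (n C s) ℕ.* (r ^ n))) k-s half ⟩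
      (- + 2) ^ℤ s * + (((A ℕ.+ ((s ℕ.+ u) ∸ s)) C A) ℕ.* (n C s) ℕ.* (r ^ n))
        ≡⟨ cong ((- + 2) ^ℤ s *_) (ℤ.pos-* (((A ℕ.+ ((s ℕ.+ u) ∸ s)) C A) ℕ.* (n C s)) (r ^ n)) ⟩
      (- + 2) ^ℤ s * (+ (((A ℕ.+ ((s ℕ.+ u) ∸ s)) C A) ℕ.* (n C s)) * + (r ^ n))
        ≡⟨ ℤ.*-assoc ((- + 2) ^ℤ s) _ _ ⟨
      q A (s ℕ.+ u) n s * + (r ^ n)
        ∎
      where
      k-s : k ∸ s ≡ A ℕ.+ ((s ℕ.+ u) ∸ s)
      k-s = trans (cong (_∸ s) (solve₃ e i s u)) (trans (ℕₚ.m+n∸n≡m (A ℕ.+ u) s) (cong (A ℕ.+_) (sym (ℕₚ.m+n∸m≡n s u))))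
        where
        solve₃ : ∀ e i s u → e ℕ.+ 2 ℕ.* (i ℕ.+ (s ℕ.+ u)) ≡ e ℕ.+ i ℕ.+ (i ℕ.+ (s ℕ.+ u)) ℕ.+ u ℕ.+ s
        solve₃ = ℕ-Solver.solve-∀

  rhsSum≡T : ∀ e J n → e ≤ 1 → rhsSum (e ℕ.+ 2 ℕ.* J) n ≡ T J e n
  rhsSum≡T zero J n _ = begin
    rhsSum (2 ℕ.* J) n                    ≡⟨ rhsSum≡∑∑ (2 ℕ.* J) n ⟩
    ∑ (suc (2 ℕ.* J)) inner               ≡⟨ ∑-even J inner (λ i → inner-vanish (2 ℕ.* J) n (suc (2 ℕ.* i)) (parity i)) ⟩
    ∑[ i < suc J ] inner (2 ℕ.* i)        ≡⟨ ∑-cong (suc J) matched ⟩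
    T J 0 n                               ∎
    where
    open ≡-Reasoning
    inner : ℕ → ℤ
    inner r = ∑[ s < suc (2 ℕ.* J) ] term (2 ℕ.* J) n r s
    parity : ∀ i → (suc (2 ℕ.* i) % 2 ≡ᵇ (2 ℕ.* J) % 2) ≡ false
    parity i = cong₂ _≡ᵇ_ ([m+2i]%2≡m%2 1 i) ([m+2i]%2≡m%2 0 J)
    matched : ∀ i → i < suc J → inner (2 ℕ.* i) ≡ t J 0 n i
    matched i (s≤s i≤J) with ℕₚ.m≤n⇒∃[o]m+o≡n i≤J
    ... | d , refl = inner-match 0 i d n
  rhsSum≡T (suc zero) J n _ = begin
    rhsSum (suc (2 ℕ.* J)) n                          ≡⟨ rhsSum≡∑∑ (suc (2 ℕ.* J)) n ⟩
    inner 0 + ∑ (suc (2 ℕ.* J)) (inner ∘ suc)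
      ≡⟨ cong₂ _+_ (inner-vanish (suc (2 ℕ.* J)) n 0 (cong (0 ≡ᵇ_) ([m+2i]%2≡m%2 1 J)))
                   (∑-even J (inner ∘ suc) (λ i → inner-vanish (suc (2 ℕ.* J)) n (suc (suc (2 ℕ.* i))) (parity i))) ⟩
    + 0 + ∑[ i < suc J ] inner (suc (2 ℕ.* i))          ≡⟨ ℤ.+-identityˡ _ ⟩
    ∑[ i < suc J ] inner (suc (2 ℕ.* i))                ≡⟨ ∑-cong (suc J) matched ⟩
    T J 1 n                                            ∎
    where
    open ≡-Reasoning
    inner : ℕ → ℤ
    inner r = ∑[ s < suc (suc (2 ℕ.* J)) ] term (suc (2 ℕ.* J)) n r s
    parity : ∀ i → (suc (suc (2 ℕ.* i)) % 2 ≡ᵇ suc (2 ℕ.* J) % 2) ≡ false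
    parity i = cong₂ _≡ᵇ_ ([m+2i]%2≡m%2 0 i) ([m+2i]%2≡m%2 1 J)
    matched : ∀ i → i < suc J → inner (suc (2 ℕ.* i)) ≡ t J 1 n i
    matched i (s≤s i≤J) with ℕₚ.m≤n⇒∃[o]m+o≡n i≤J
    ... | d , refl = inner-match 1 i d n
  rhsSum≡T (suc (suc e)) J n (s≤s ())

  parity-split : ∀ k → ∃₂ λ e J → e ≤ 1 × k ≡ e ℕ.+ 2 ℕ.* J
  parity-split k = k % 2 , k / 2 , ℕₚ.≤-pred (m%n<n k 2) , trans (m≡m%n+[m/n]*n k 2) (cong (k % 2 ℕ.+_) (ℕₚ.*-comm (k / 2) 2))

  2+[e+2J]≡e+2[1+J] : ∀ e J → suc (suc (e ℕ.+ 2 ℕ.* J)) ≡ e ℕ.+ 2 ℕ.* suc J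
  2+[e+2J]≡e+2[1+J] = ℕ-Solver.solve-∀

  rhsSum-rec : ∀ k n →
    rhsSum (suc (suc k)) (suc n) ≡ + suc (suc k) * rhsSum (suc (suc k)) n + + 4 * (+ suc n - + suc (suc k)) * rhsSum k n
  rhsSum-rec k n with parity-split k
  ... | e , J , e≤1 , refl = begin
    rhsSum k′ (suc n)                                         ≡⟨ at (suc n) ⟩
    T (suc J) e (suc n)                                       ≡⟨ T-rec J e n ⟩
    + K * T (suc J) e n + + 4 * (+ suc n - + K) * T J e n     ≡⟨ cong₂ (λ u v → + K * u + + 4 * (+ suc n - + K) * v)
                                                                       (at n) (rhsSum≡T e J n e≤1) ⟨
    + K * rhsSum k′ n + + 4 * (+ suc n - + K) * rhsSum k n    ≡⟨ cong (λ m → + m * rhsSum k′ n + + 4 * (+ suc n - + m) * rhsSum k n) k′≡K ⟨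
    + k′ * rhsSum k′ n + + 4 * (+ suc n - + k′) * rhsSum k n  ∎
    where
    open ≡-Reasoning
    k′ = suc (suc k)
    K = e ℕ.+ 2 ℕ.* suc J
    k′≡K : k′ ≡ K
    k′≡K = 2+[e+2J]≡e+2[1+J] e J
    at : ∀ m → rhsSum k′ m ≡ T (suc J) e m
    at m = trans (cong (λ x → rhsSum x m) k′≡K) (rhsSum≡T e (suc J) m e≤1)

  rhsSum-at-1 : ∀ k → rhsSum (suc k) 1 ≡ + (2 ^ k)
  rhsSum-at-1 k with parity-split k
  ... | zero , J , _ , refl = begin
    rhsSum (suc (2 ℕ.* J)) 1   ≡⟨ rhsSum≡T 1 J 1 (s≤s z≤n) ⟩
    T J 1 1                    ≡⟨ T-one-odd J ⟩
    + (4 ^ J)                  ≡⟨ cong +_ (ℕₚ.^-*-assoc 2 2 J) ⟩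
    + (2 ^ (2 ℕ.* J))          ∎
    where open ≡-Reasoning
  ... | suc zero , J , _ , refl = begin
    rhsSum (suc (suc (2 ℕ.* J))) 1   ≡⟨ cong (λ m → rhsSum m 1) (sym (ℕₚ.*-suc 2 J)) ⟩
    rhsSum (2 ℕ.* suc J) 1           ≡⟨ rhsSum≡T 0 (suc J) 1 z≤n ⟩
    T (suc J) 0 1                    ≡⟨ T-one-even J ⟩
    + (2 ℕ.* 4 ^ J)                  ≡⟨ cong (λ m → + (2 ℕ.* m)) (ℕₚ.^-*-assoc 2 2 J) ⟩
    + (2 ^ suc (2 ℕ.* J))            ∎
    where open ≡-Reasoning
  ... | suc (suc _) , _ , s≤s () , _

  rhsSum-k=0 : ∀ n → rhsSum 0 (suc n) ≡ + 0
  rhsSum-k=0 n = refl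

  rhsSum-k=1 : ∀ n → rhsSum 1 n ≡ + 1
  rhsSum-k=1 n = trans (rhsSum≡T 1 0 n (s≤s z≤n))
    (trans (ℤ.+-identityʳ _) (trans (cong₂ _*_ (Q-zeroᵐ 1 n) (cong +_ (ℕₚ.^-zeroˡ n))) refl))

  x+y-y≡x : ∀ x y → x + y - y ≡ x
  x+y-y≡x = solve-∀

  2^[1+k]*b≡4*2^[k-1]*b : ∀ k n → 1 ≤ n → 2 ^ suc k ℕ.* b k n ≡ 4 ℕ.* (2 ^ (k ∸ 1) ℕ.* b k n)
  2^[1+k]*b≡4*2^[k-1]*b zero    n 1≤n rewrite b-zero n 1≤n = refl
  2^[1+k]*b≡4*2^[k-1]*b (suc k) n 1≤n = regroup (2 ^ k) (b (suc k) n)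
    where
    regroup : ∀ p x → 2 ℕ.* (2 ℕ.* p) ℕ.* x ≡ 4 ℕ.* (p ℕ.* x)
    regroup = ℕ-Solver.solve-∀

  scaled-b-rec : ∀ k n → 1 ≤ n →
    + (2 ^ suc k ℕ.* b (suc (suc k)) (suc n))
      ≡ + suc (suc k) * + (2 ^ suc k ℕ.* b (suc (suc k)) n) + + 4 * (+ suc n - + suc (suc k)) * + (2 ^ (k ∸ 1) ℕ.* b k n)
  scaled-b-rec k n 1≤n = begin
    + (P ℕ.* X)                                      ≡⟨ ℤ.pos-* P X ⟩
    + P * + X                                        ≡⟨ cong (+ P *_) X≡ ⟩
    + P * (K * + Z + (M - K) * + Y)                  ≡⟨ regroup (+ P) K M (+ Z) (+ Y) ⟩
    K * (+ P * + Z) + (M - K) * (+ P * + Y)          ≡⟨ cong₂ (λ u v → K * u + (M - K) * v) (ℤ.pos-* P Z) (sym PY≡) ⟨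
    K * + (P ℕ.* Z) + (M - K) * (+ 4 * + Y′)         ≡⟨ reorder K M (+ (P ℕ.* Z)) (+ Y′) ⟩
    K * + (P ℕ.* Z) + + 4 * (M - K) * + Y′           ∎
    where
    open ≡-Reasoning
    P = 2 ^ suc k
    X = b (suc (suc k)) (suc n)
    Y = b k n
    Y′ = 2 ^ (k ∸ 1) ℕ.* Y
    Z = b (suc (suc k)) n
    K = + suc (suc k)
    M = + suc n
    recurrence : + X + K * + Y ≡ K * + Z + M * + Y
    recurrence = begin
      + X + K * + Y                          ≡⟨ cong (_+_ (+ X)) (ℤ.pos-* (suc (suc k)) Y) ⟨
      + X + + (suc (suc k) ℕ.* Y)            ≡⟨ ℤ.pos-+ X (suc (suc k) ℕ.* Y) ⟨
      + (X ℕ.+ suc (suc k) ℕ.* Y)            ≡⟨ cong +_ (b-suc (suc (suc k)) n 1≤n) ⟩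
      + (suc (suc k) ℕ.* Z ℕ.+ suc n ℕ.* Y)  ≡⟨ ℤ.pos-+ (suc (suc k) ℕ.* Z) (suc n ℕ.* Y) ⟩
      + (suc (suc k) ℕ.* Z) + + (suc n ℕ.* Y) ≡⟨ cong₂ _+_ (ℤ.pos-* (suc (suc k)) Z) (ℤ.pos-* (suc n) Y) ⟩
      K * + Z + M * + Y                      ∎
    collect : ∀ k z m y → k * z + m * y - k * y ≡ k * z + (m - k) * y
    collect = solve-∀
    X≡ : + X ≡ K * + Z + (M - K) * + Y
    X≡ = trans (sym (x+y-y≡x (+ X) (K * + Y))) (trans (cong (_- K * + Y) recurrence) (collect K (+ Z) M (+ Y)))
    PY≡ : + P * + Y ≡ + 4 * + Y′
    PY≡ = trans (sym (ℤ.pos-* P Y)) (trans (cong +_ (2^[1+k]*b≡4*2^[k-1]*b k n 1≤n)) (ℤ.pos-* 4 Y′))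
    regroup : ∀ p k m z y → p * (k * z + (m - k) * y) ≡ k * (p * z) + (m - k) * (p * y)
    regroup = solve-∀
    reorder : ∀ k m z y → k * z + (m - k) * (+ 4 * y) ≡ k * z + + 4 * (m - k) * y
    reorder = solve-∀

  scaled-b≡rhsSum : ∀ n k → + (2 ^ (k ∸ 1) ℕ.* b k (suc n)) ≡ rhsSum k (suc n)
  scaled-b≡rhsSum zero    zero          = refl
  scaled-b≡rhsSum zero    (suc k)       = trans (cong +_ (ℕₚ.*-identityʳ (2 ^ k))) (sym (rhsSum-at-1 k))
  scaled-b≡rhsSum (suc n) zero          = trans (cong (λ m → + (1 ℕ.* m)) (b-zero (suc (suc n)) (s≤s z≤n))) (sym (rhsSum-k=0 (suc n)))
  scaled-b≡rhsSum (suc n) (suc zero)    = trans (cong (λ m → + (1 ℕ.* m)) (b-one (suc n))) (sym (rhsSum-k=1 (suc (suc n))))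
  scaled-b≡rhsSum (suc n) (suc (suc k)) = begin
    + (2 ^ suc k ℕ.* b (suc (suc k)) (suc (suc n)))
      ≡⟨ scaled-b-rec k (suc n) (s≤s z≤n) ⟩
    K * + (2 ^ suc k ℕ.* b (suc (suc k)) (suc n)) + + 4 * (+ suc (suc n) - K) * + (2 ^ (k ∸ 1) ℕ.* b k (suc n))
      ≡⟨ cong₂ (λ u v → K * u + + 4 * (+ suc (suc n) - K) * v) (scaled-b≡rhsSum n (suc (suc k))) (scaled-b≡rhsSum n k) ⟩
    K * rhsSum (suc (suc k)) (suc n) + + 4 * (+ suc (suc n) - K) * rhsSum k (suc n)
      ≡⟨ rhsSum-rec k (suc n) ⟨
    rhsSum (suc (suc k)) (suc (suc n))
      ∎
    where
    open ≡-Reasoning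
    K = + suc (suc k)

  a≡b-b : ∀ k n → + a (suc k) n ≡ + b (suc k) n - + b k n
  a≡b-b k n = trans (sym (x+y-y≡x (+ a (suc k) n) (+ b k n)))
                    (cong (_- + b k n) (trans (sym (ℤ.pos-+ (a (suc k) n) (b k n))) (cong +_ (a+b≡b k n))))

open import Data.Nat using (ℕ; suc; _≤_; _∸_; _^_; _*_)
open import Data.Integer as ℤ using (ℤ; +_; _-_)
open import Data.Product using (_×_; _,_)
open import Relation.Binary.PropositionalEquality using (_≡_)
open ClosedForm using (scaled-b≡rhsSum; a≡b-b)

corollary3p1 : (k n : ℕ) → 1 ≤ k → 1 ≤ n →
    (+ (2 ^ (k ∸ 1) * b k n) ≡ rhsSum k n)
      × (+ a k n ≡ + b k n - + b (k ∸ 1) n)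
corollary3p1 (suc k) (suc n) _ _ = scaled-b≡rhsSum n (suc k) , a≡b-b k (suc n)
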